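{- Let $G$ be a simple graph with vertex set $[d]$ and let $\chi_G$ be its chromatic polynomial. Define the polynomial $W_G(t)$ by $$\sum_{n\ge 0}\chi_G(n)t^n=\frac{W_G(t)}{(1-t)^{d+1}}.$$ Then $$W_G(t)=\sum_{\pi\in\mathcal S_d}t^{c(\pi)},$$ where $c(\pi)$ is the number of cuts of $\pi$ with respect to $G$. In particular, $\sum_{\pi\in\mathcal S_d}t^{c(\pi)}$ is independent of the labeling of the vertices of $G$ by $[d]$.
   Context: $G$ is a simple graph (no loops, no multiple edges) with vertex set $[d]$. An $n$-coloring of $G$ is a map $\phi:[d]\to[n]$ (not necessarily surjective) with $\phi(x)\ne\phi(y)$ whenever $x,y$ are adjacent; $\chi_G(n)$ is the number of $n$-colorings. A path of length $r$ in $G$ is a sequence of vertices $v_0,\dots,v_r$ with consecutive vertices adjacent. For $\pi=a_1a_2\cdots a_d\in\mathcal S_d$ and $k\in[d]$, $\ell(k)$ is the largest $r\ge0$ such that there are indices $i_0<i_1<\cdots<i_r=k$ with $a_{i_0},\dots,a_{i_r}$ a path in $G$. An integer $k\in\{0,1,\dots,d-1\}$ is a cut of $\pi$ if $k=0$, or $\ell(k)<\ell(k+1)$, or $\ell(k)=\ell(k+1)$ and $a_k<a_{k+1}$. $c(\pi)$ is the number of cuts (so $0$ is always counted). -}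

module Defs where

open import Data.Bool using (Bool; true; false; _∧_; _∨_; not; if_then_else_; T?)
open import Data.Nat using (ℕ; zero; suc; _+_; _∸_; _⊔_; _≤ᵇ_; _<?_; _≡ᵇ_)
open import Data.Nat.Combinatorics using (_C_)
open import Data.Fin using (Fin; toℕ; fromℕ<) renaming (zero to fzero; suc to fsuc)
open import Data.Fin.Permutation using (Permutation′; _⟨$⟩ʳ_)
open import Data.List using (List; []; _∷_; map; concatMap; filter; length; foldr; upTo; allFin; _++_; [_])
open import Data.Integer using (ℤ; +_; -_) renaming (_+_ to _+ℤ_; _*_ to _*ℤ_)
open import Relation.Nullary.Decidable using (yes; no; ⌊_⌋)
open import Relation.Binary.PropositionalEquality using (_≡_)

allB : ∀ {A : Set} → (A → Bool) → List A → Bool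
allB f = foldr (λ x b → f x ∧ b) true

_==_ : ∀ {n} → Fin n → Fin n → Bool
x == y = toℕ x ≡ᵇ toℕ y

record SimpleGraph (d : ℕ) : Set where
  field
    adj    : Fin d → Fin d → Bool
    sym    : ∀ x y → adj x y ≡ adj y x
    irrefl : ∀ x → adj x x ≡ false
open SimpleGraph public

relabel : ∀ {d} → SimpleGraph d → Permutation′ d → SimpleGraph d
relabel G σ = record
  { adj    = λ x y → adj G (σ ⟨$⟩ʳ x) (σ ⟨$⟩ʳ y)
  ; sym    = λ x y → sym G (σ ⟨$⟩ʳ x) (σ ⟨$⟩ʳ y)
  ; irrefl = λ x → irrefl G (σ ⟨$⟩ʳ x) }

consF : ∀ {d n} → Fin n → (Fin d → Fin n) → Fin (suc d) → Fin n
consF c f fzero    = c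
consF c f (fsuc i) = f i

allMaps : (d n : ℕ) → List (Fin d → Fin n)
allMaps zero    n = [ (λ ()) ]
allMaps (suc d) n = concatMap (λ c → map (consF c) (allMaps d n)) (allFin n)

isProper : ∀ {d n} → SimpleGraph d → (Fin d → Fin n) → Bool
isProper {d} G φ = allB (λ x → allB (λ y → not (adj G x y) ∨ not (φ x == φ y)) (allFin d)) (allFin d)

χ : ∀ {d} → SimpleGraph d → ℕ → ℕ
χ {d} G n = length (filter (λ φ → T? (isProper G φ)) (allMaps d n))

-- the symmetric group S_d: words a_1 … a_d (position i ↦ a_{i+1}) with distinct letters
isInjective : ∀ {d} → (Fin d → Fin d) → Bool
isInjective {d} p = allB (λ x → allB (λ y → not (p x == p y) ∨ (x == y)) (allFin d)) (allFin d)

perms : (d : ℕ) → List (Fin d → Fin d)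
perms d = filter (λ p → T? (isInjective p)) (allMaps d d)

subs : ∀ {A : Set} → List A → List (List A)
subs []       = [ [] ]
subs (x ∷ xs) = let r = subs xs in map (x ∷_) r ++ r

isPath : ∀ {d} → SimpleGraph d → List (Fin d) → Bool
isPath G []           = true
isPath G (x ∷ [])     = true
isPath G (x ∷ y ∷ xs) = adj G x y ∧ isPath G (y ∷ xs)

-- ℓ(k) (0-based position k): largest r such that there are positions
-- i_0 < … < i_r = k with a_{i_0},…,a_{i_r} a path in G.
ell : ∀ {d} → SimpleGraph d → (Fin d → Fin d) → Fin d → ℕ
ell {d} G p k =
  foldr _⊔_ 0
    (map length
      (filter (λ s → T? (isPath G (map p (s ++ [ k ]))))
        (subs (filter (λ i → toℕ i <? toℕ k) (allFin d)))))

-- is k ∈ {0,…,d-1} a cut (1-based positions as in the paper: a_k is at 0-based index k-1)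
isCut : ∀ {d} → SimpleGraph d → (Fin d → Fin d) → ℕ → Bool
isCut G p zero = true
isCut {d} G p (suc j) with j <? d | suc j <? d
... | yes j<d | yes sj<d =
  let k  = fromℕ< j<d
      k' = fromℕ< sj<d
  in (ell G p k Data.Nat.<ᵇ ell G p k')
     ∨ ((ell G p k ≡ᵇ ell G p k') ∧ (toℕ (p k) Data.Nat.<ᵇ toℕ (p k')))
  where import Data.Nat
... | _ | _ = false

cuts : ∀ {d} → SimpleGraph d → (Fin d → Fin d) → ℕ
cuts {d} G p = length (filter (λ k → T? (isCut G p k)) (upTo d))

cutCoeff : ∀ {d} → SimpleGraph d → ℕ → ℕ
cutCoeff {d} G m = length (filter (λ p → cuts G p Data.Nat.≟ m) (perms d))
  where import Data.Nat

-- coefficient of t^m in (1-t)^{d+1} · Σ_{n≥0} χ_G(n) t^n, i.e. of W_G(t):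
--   Σ_{j=0}^{min(m,d+1)} (-1)^j C(d+1, j) χ_G(m-j)
sumℤ : List ℤ → ℤ
sumℤ = foldr _+ℤ_ (+ 0)

signℤ : ℕ → ℤ
signℤ zero    = + 1
signℤ (suc j) = - signℤ j

WCoeff : ∀ {d} → SimpleGraph d → ℕ → ℤ
WCoeff {d} G m =
  sumℤ (map (λ j → if j ≤ᵇ m
                     then signℤ j *ℤ (+ ((suc d) C j)) *ℤ (+ χ G (m ∸ j))
                     else + 0)
            (upTo (suc (suc d))))

module Submission where

-- A proper n-colouring φ determines a unique permutation π listing the vertices by increasing colour,
-- then by decreasing height (the length of the longest path into the vertex along which colours
-- increase), then by decreasing label.  Along such a π the function ℓ is the height, so the cuts of π
-- are exactly the positions where the colours read along π must increase strictly; conversely a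
-- colour sequence that weakly increases along a permutation and strictly at its cuts is proper and
-- sorted by it.  Hence χ_G(n) = Σ_π C(n - c(π) + d, d), the coefficient of t^n in
-- t^c(π) / (1 - t)^(d+1), and multiplying by (1 - t)^(d+1) leaves Σ_π t^c(π).  Relabelling does not
-- change χ_G, hence not W_G.

open import Data.Bool using (Bool; true; false; T; T?; _∧_; _∨_; not; if_then_else_)
open import Data.Bool.Properties using (T-≡; T-∧; T-∨; ∧-identityʳ; ∧-assoc; if-float)
open import Data.Empty using (⊥-elim)
open import Data.Fin as Fin using (Fin; zero; suc; toℕ; fromℕ<; punchOut)
open import Data.Fin.Permutation using (Permutation′; permutation; flip; _⟨$⟩ʳ_; _⟨$⟩ˡ_; inverseˡ; inverseʳ)
open import Data.Fin.Properties
  using (_≟_; any?; toℕ-injective; toℕ<n; toℕ-fromℕ<; toℕ-fromℕ; toℕ-inject₁; punchOut-injective; injective⇒≤)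
open import Data.Integer using (ℤ; +_) renaming (_+_ to _+ℤ_; _*_ to _*ℤ_; _-_ to _-ℤ_; -_ to -ℤ_)
import Data.Integer.Properties as ℤ
open import Data.Integer.Solver using (module +-*-Solver)
open import Data.List
  using (List; []; _∷_; _++_; [_]; map; concatMap; filter; length; foldr; allFin; tabulate; applyUpTo; upTo; initLast; _∷ʳ′_)
open import Data.List.Membership.Propositional using (_∈_)
open import Data.List.Membership.Propositional.Properties
  using (∈-allFin; ∈-++⁻; ∈-++⁺ˡ; ∈-++⁺ʳ; ∈-map⁺; ∈-map⁻; ∈-filter⁺; ∈-filter⁻)
open import Data.List.Properties using (map-++; map-cong; map-cong-local; length-++)
open import Data.List.Relation.Binary.Sublist.Propositional using (_⊆_; []; _∷_; _∷ʳ_; minimum)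
open import Data.List.Relation.Binary.Sublist.Propositional.Properties using (All-resp-⊆)
open import Data.List.Relation.Unary.All as All using (All; []; _∷_)
open import Data.List.Relation.Unary.All.Properties using (∷ʳ⁺; ∷ʳ⁻; all-filter) renaming (map⁺ to All-map⁺)
open import Data.List.Relation.Unary.AllPairs using (AllPairs; []; _∷_)
import Data.List.Relation.Unary.AllPairs.Properties as AllPairs
open import Data.List.Relation.Unary.Any using (here; there)
open import Data.Nat using (ℕ; zero; suc; _+_; _*_; _∸_; _⊔_; _≤_; _<_; z≤n; s≤s; _≤ᵇ_; _<ᵇ_; _≡ᵇ_; _<?_)
open import Data.Nat.Combinatorics using (_C_; nCn≡1; k>n⇒nCk≡0; nCk+nC[k+1]≡[n+1]C[k+1])
open import Data.Nat.ListAction using (sum)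
open import Data.Nat.ListAction.Properties using (sum-++)
open import Data.Nat.Properties renaming (_≟_ to _≟ℕ_)
open import Data.Product using (_×_; _,_; proj₁; proj₂; ∃; uncurry)
open import Data.Product.Relation.Binary.Lex.Strict using (×-Lex; ×-strictTotalOrder)
open import Data.Sum using (_⊎_; inj₁; inj₂; [_,_]′)
open import Function using (id; _∘_; _⇔_; mk⇔; Injective)
open import Function.Bundles using (Equivalence)
open import Level using (0ℓ)
open import Relation.Binary using (tri<; tri≈; tri>)
open import Relation.Binary.Bundles using (StrictTotalOrder)
import Relation.Binary.Construct.Flip.Ord as Flip
open import Relation.Binary.PropositionalEquality hiding ([_])
open import Relation.Nullary using (¬_; Dec; yes; no; does; _×-dec_)
open import Relation.Nullary.Decidable using (map′; does-⇔; dec-true; dec-false)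
open import Relation.Unary using (Pred; Decidable)

open import Algebra.Properties.CommutativeSemigroup +-commutativeSemigroup
  using () renaming (interchange to +-interchange)
import Algebra.Properties.CommutativeMonoid.Sum
open import Algebra.Properties.CommutativeMonoid.Sum +-0-commutativeMonoid
  using (sum-syntax; sum-cong-≗; ∑-permute; ∑-distrib-+; sum-replicate-zero)
  renaming (sum to sumFin)
open import Algebra.Properties.CommutativeMonoid.Sum ⊔-0-commutativeMonoid
  using () renaming (sum to ⨆; sum-cong-≗ to ⨆-cong; ∑-permute to ⨆-permute)

open import Defs hiding (sym)

-- Sums and indicators

𝟙 : Bool → ℕ
𝟙 true  = 1
𝟙 false = 0

𝟙-∧ : ∀ a b → 𝟙 (a ∧ b) ≡ 𝟙 a * 𝟙 b
𝟙-∧ true  b = sym (*-identityˡ (𝟙 b))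
𝟙-∧ false b = refl

𝟙-true : ∀ {b} → T b → 𝟙 b ≡ 1
𝟙-true {true} _ = refl

𝟙-false : ∀ {b} → ¬ T b → 𝟙 b ≡ 0
𝟙-false {false} _  = refl
𝟙-false {true}  ¬t = ⊥-elim (¬t _)

module _ {A : Set} where

  sumOver : (A → ℕ) → List A → ℕ
  sumOver f xs = sum (map f xs)

  syntax sumOver (λ x → e) xs = ∑[ x ∈ xs ] e

  sumOver-cong : ∀ {f g : A → ℕ} → f ≗ g → ∀ xs → sumOver f xs ≡ sumOver g xs
  sumOver-cong f≗g xs = cong sum (map-cong f≗g xs)

  sumOver-++ : ∀ (f : A → ℕ) xs ys → sumOver f (xs ++ ys) ≡ sumOver f xs + sumOver f ys
  sumOver-++ f xs ys = trans (cong sum (map-++ f xs ys)) (sum-++ (map f xs) (map f ys))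

  sumOver-zero : ∀ xs → ∑[ x ∈ xs ] 0 ≡ 0
  sumOver-zero []       = refl
  sumOver-zero (x ∷ xs) = sumOver-zero xs

  sumOver-distrib-+ : ∀ (f g : A → ℕ) xs → ∑[ x ∈ xs ] (f x + g x) ≡ sumOver f xs + sumOver g xs
  sumOver-distrib-+ f g []       = refl
  sumOver-distrib-+ f g (x ∷ xs) =
    trans (cong (_+_ (f x + g x)) (sumOver-distrib-+ f g xs)) (+-interchange (f x) (g x) _ _)

  sumOver-*ˡ : ∀ k (f : A → ℕ) xs → ∑[ x ∈ xs ] (k * f x) ≡ k * sumOver f xs
  sumOver-*ˡ k f []       = sym (*-zeroʳ k)
  sumOver-*ˡ k f (x ∷ xs) = trans (cong (_+_ (k * f x)) (sumOver-*ˡ k f xs)) (sym (*-distribˡ-+ k (f x) _))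

  sumOver-filter : ∀ {P : Pred A 0ℓ} (P? : Decidable P) (f : A → ℕ) xs →
                   sumOver f (filter P? xs) ≡ ∑[ x ∈ xs ] (𝟙 (does (P? x)) * f x)
  sumOver-filter P? f []       = refl
  sumOver-filter P? f (x ∷ xs) with does (P? x)
  ... | true  = cong₂ _+_ (sym (+-identityʳ (f x))) (sumOver-filter P? f xs)
  ... | false = sumOver-filter P? f xs

  length-filter≡sumOver : ∀ {P : Pred A 0ℓ} (P? : Decidable P) xs →
                          length (filter P? xs) ≡ ∑[ x ∈ xs ] 𝟙 (does (P? x))
  length-filter≡sumOver P? []       = refl
  length-filter≡sumOver P? (x ∷ xs) with does (P? x)
  ... | true  = cong suc (length-filter≡sumOver P? xs)
  ... | false = length-filter≡sumOver P? xs

module _ {A B : Set} where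

  sumOver-map : ∀ (f : B → ℕ) (g : A → B) xs → sumOver f (map g xs) ≡ sumOver (f ∘ g) xs
  sumOver-map f g []       = refl
  sumOver-map f g (x ∷ xs) = cong (_+_ (f (g x))) (sumOver-map f g xs)

  sumOver-concatMap : ∀ (f : B → ℕ) (g : A → List B) xs →
                      sumOver f (concatMap g xs) ≡ ∑[ x ∈ xs ] sumOver f (g x)
  sumOver-concatMap f g []       = refl
  sumOver-concatMap f g (x ∷ xs) =
    trans (sumOver-++ f (g x) (concatMap g xs)) (cong (_+_ (sumOver f (g x))) (sumOver-concatMap f g xs))

  sumOver-comm : ∀ (w : A → B → ℕ) xs ys →
                 ∑[ x ∈ xs ] ∑[ y ∈ ys ] w x y ≡ ∑[ y ∈ ys ] ∑[ x ∈ xs ] w x y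
  sumOver-comm w []       ys = sym (sumOver-zero ys)
  sumOver-comm w (x ∷ xs) ys =
    trans (cong (_+_ (sumOver (w x) ys)) (sumOver-comm w xs ys)) (sym (sumOver-distrib-+ (w x) _ ys))

sumOver-tabulate : ∀ {A : Set} {n} (f : A → ℕ) (g : Fin n → A) → sumOver f (tabulate g) ≡ ∑[ i < n ] f (g i)
sumOver-tabulate {n = zero}  f g = refl
sumOver-tabulate {n = suc n} f g = cong (_+_ (f (g zero))) (sumOver-tabulate f (g ∘ suc))

sumOver-allFin : ∀ {n} (f : Fin n → ℕ) → ∑[ i ∈ allFin n ] f i ≡ ∑[ i < n ] f i
sumOver-allFin f = sumOver-tabulate f (λ i → i)

sumOver-*ʳ : ∀ {A : Set} k (f : A → ℕ) xs → ∑[ x ∈ xs ] (f x * k) ≡ sumOver f xs * k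
sumOver-*ʳ k f xs = trans (sumOver-cong (λ x → *-comm (f x) k) xs) (trans (sumOver-*ˡ k f xs) (*-comm k _))

sumOver-cong-∈ : ∀ {A : Set} {f g : A → ℕ} xs → (∀ {x} → x ∈ xs → f x ≡ g x) → sumOver f xs ≡ sumOver g xs
sumOver-cong-∈ xs f≡g = cong sum (map-cong-local (All.tabulate f≡g))

sumOver-applyUpTo : ∀ {A : Set} (f : A → ℕ) (g : ℕ → A) k → sumOver f (applyUpTo g k) ≡ ∑[ j < k ] f (g (toℕ j))
sumOver-applyUpTo f g zero    = refl
sumOver-applyUpTo f g (suc k) = cong (_+_ (f (g 0))) (sumOver-applyUpTo f (g ∘ suc) k)

𝟙≤1 : ∀ b → 𝟙 b ≤ 1
𝟙≤1 true  = ≤-refl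
𝟙≤1 false = z≤n

sum-mono-≤ : ∀ {m} {f g : Fin m → ℕ} → (∀ i → f i ≤ g i) → sumFin f ≤ sumFin g
sum-mono-≤ {zero}  f≤g = z≤n
sum-mono-≤ {suc m} f≤g = +-mono-≤ (f≤g zero) (sum-mono-≤ (f≤g ∘ suc))

sum-mono-< : ∀ {m} {f g : Fin m → ℕ} → (∀ i → f i ≤ g i) → ∀ j → f j < g j → sumFin f < sumFin g
sum-mono-< f≤g zero    fj<gj = +-mono-<-≤ fj<gj (sum-mono-≤ (f≤g ∘ suc))
sum-mono-< f≤g (suc j) fj<gj = +-mono-≤-< (f≤g zero) (sum-mono-< (f≤g ∘ suc) j fj<gj)

∑-1 : ∀ m → ∑[ i < m ] 1 ≡ m
∑-1 zero    = refl
∑-1 (suc m) = cong suc (∑-1 m)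

∑-𝟙< : ∀ {m} (j : Fin m) → ∑[ i < m ] 𝟙 (does (toℕ i <? toℕ j)) ≡ toℕ j
∑-𝟙< {suc m} zero    = sum-replicate-zero m
∑-𝟙< {suc m} (suc j) = cong suc (∑-𝟙< j)

∑-indicator : ∀ {n} (v : Fin n) (f : Fin n → ℕ) → ∑[ c < n ] (𝟙 (does (c ≟ v)) * f c) ≡ f v
∑-indicator {suc n} zero    f = trans (cong₂ _+_ (+-identityʳ (f zero)) (sum-replicate-zero n)) (+-identityʳ _)
∑-indicator {suc n} (suc v) f = ∑-indicator v (f ∘ suc)

∑-𝟙-not+∑-𝟙 : ∀ {d} (b : Fin d → Bool) → ∑[ i < d ] 𝟙 (not (b i)) + ∑[ i < d ] 𝟙 (b i) ≡ d
∑-𝟙-not+∑-𝟙 {d} b = trans (sym (∑-distrib-+ (λ i → 𝟙 (not (b i))) (λ i → 𝟙 (b i))))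
                           (trans (sum-cong-≗ (λ i → 𝟙-not+𝟙 (b i))) (∑-1 d))
  where
  𝟙-not+𝟙 : ∀ b → 𝟙 (not b) + 𝟙 b ≡ 1
  𝟙-not+𝟙 true  = refl
  𝟙-not+𝟙 false = refl

𝟙-≤ᵇ-split : ∀ l m → 𝟙 (l ≤ᵇ m) ≡ 𝟙 (does (m ≟ℕ l)) + 𝟙 (suc l ≤ᵇ m)
𝟙-≤ᵇ-split l m with <-cmp l m
... | tri< l<m _ _ = trans (𝟙-true (≤⇒≤ᵇ (<⇒≤ l<m)))
                       (sym (cong₂ _+_ (𝟙-false (<⇒≢ l<m ∘ sym ∘ ≡ᵇ⇒≡ m l)) (𝟙-true (≤⇒≤ᵇ l<m))))
... | tri≈ _ l≡m _ = trans (𝟙-true (≤⇒≤ᵇ (≤-reflexive l≡m)))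
                       (sym (cong₂ _+_ (𝟙-true (≡⇒≡ᵇ m l (sym l≡m))) (𝟙-false (<-irrefl l≡m ∘ ≤ᵇ⇒≤ (suc l) m))))
... | tri> _ _ m<l = trans (𝟙-false (<⇒≱ m<l ∘ ≤ᵇ⇒≤ l m))
                       (sym (cong₂ _+_ (𝟙-false (<⇒≢ m<l ∘ ≡ᵇ⇒≡ m l)) (𝟙-false (<⇒≱ m<l ∘ <⇒≤ ∘ ≤ᵇ⇒≤ (suc l) m))))

∑-indicatorℕ : ∀ {n} l → l < n → (f : ℕ → ℕ) → ∑[ c < n ] (𝟙 (does (toℕ c ≟ℕ l)) * f (toℕ c)) ≡ f l
∑-indicatorℕ {n} l l<n f = begin
  ∑[ c < n ] (𝟙 (does (toℕ c ≟ℕ l)) * f (toℕ c))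
    ≡⟨ sum-cong-≗ (λ c → cong (λ b → 𝟙 b * f (toℕ c)) (does-⇔ (toℕ≡⇔ c) (toℕ c ≟ℕ l) (c ≟ fromℕ< l<n))) ⟩
  ∑[ c < n ] (𝟙 (does (c ≟ fromℕ< l<n)) * f (toℕ c))
    ≡⟨ ∑-indicator (fromℕ< l<n) (f ∘ toℕ) ⟩
  f (toℕ (fromℕ< l<n))
    ≡⟨ cong f (toℕ-fromℕ< l<n) ⟩
  f l ∎
  where
  open ≡-Reasoning
  toℕ≡⇔ : ∀ c → (toℕ c ≡ l) ⇔ (c ≡ fromℕ< l<n)
  toℕ≡⇔ c = mk⇔ (λ e → toℕ-injective (trans e (sym (toℕ-fromℕ< l<n)))) (λ e → trans (cong toℕ e) (toℕ-fromℕ< l<n))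

T-not : ∀ {b} → T (not b) ⇔ (¬ T b)
T-not {true}  = mk⇔ (λ ()) (λ ¬t → ¬t _)
T-not {false} = mk⇔ (λ _ ()) (λ _ → _)

T-→ : ∀ {a b} → T (not a ∨ b) ⇔ (T a → T b)
T-→ {true}  = mk⇔ (λ t _ → t) (λ f → f _)
T-→ {false} = mk⇔ (λ _ ()) (λ _ → _)

T-== : ∀ {n} {x y : Fin n} → T (x == y) ⇔ (x ≡ y)
T-== {x = x} {y} = mk⇔ (toℕ-injective ∘ ≡ᵇ⇒≡ (toℕ x) (toℕ y)) (≡⇒≡ᵇ (toℕ x) (toℕ y) ∘ cong toℕ)

T-allB : ∀ {A : Set} (f : A → Bool) xs → T (allB f xs) ⇔ All (T ∘ f) xs
T-allB f []       = mk⇔ (λ _ → []) (λ _ → _)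
T-allB f (x ∷ xs) = mk⇔
  (λ t → let (fx , rest) = Equivalence.to T-∧ t in fx ∷ Equivalence.to (T-allB f xs) rest)
  (λ { (fx ∷ rest) → Equivalence.from T-∧ (fx , Equivalence.from (T-allB f xs) rest) })

T-allB-allFin² : ∀ {d} (r : Fin d → Fin d → Bool) →
                 T (allB (λ x → allB (r x) (allFin d)) (allFin d)) ⇔ (∀ x y → T (r x y))
T-allB-allFin² {d} r = mk⇔
  (λ t x y → All.lookup (to (T-allB (r x) (allFin d)) (All.lookup (to (T-allB rows (allFin d)) t) (∈-allFin x))) (∈-allFin y))
  (λ h → from (T-allB rows (allFin d)) (All.tabulate (λ {x} _ → from (T-allB (r x) (allFin d)) (All.tabulate (λ {y} _ → h x y)))))
  where
  open Equivalence
  rows : Fin d → Bool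
  rows x = allB (r x) (allFin d)

T-lex : ∀ {a b x y} → T ((a <ᵇ b) ∨ ((a ≡ᵇ b) ∧ (x <ᵇ y))) ⇔ ×-Lex _≡_ _<_ _<_ (a , x) (b , y)
T-lex {a} {b} {x} {y} = mk⇔ to from
  where
  to : T ((a <ᵇ b) ∨ ((a ≡ᵇ b) ∧ (x <ᵇ y))) → ×-Lex _≡_ _<_ _<_ (a , x) (b , y)
  to t with Equivalence.to T-∨ t
  ... | inj₁ a<b = inj₁ (<ᵇ⇒< a b a<b)
  ... | inj₂ a=b∧x<y = let (a=b , x<y) = Equivalence.to T-∧ a=b∧x<y in inj₂ (≡ᵇ⇒≡ a b a=b , <ᵇ⇒< x y x<y)
  from : ×-Lex _≡_ _<_ _<_ (a , x) (b , y) → T ((a <ᵇ b) ∨ ((a ≡ᵇ b) ∧ (x <ᵇ y)))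
  from (inj₁ a<b)         = Equivalence.from T-∨ (inj₁ (<⇒<ᵇ a<b))
  from (inj₂ (a≡b , x<y)) = Equivalence.from T-∨ (inj₂ (Equivalence.from T-∧ (≡⇒≡ᵇ a b a≡b , <⇒<ᵇ x<y)))

+𝟙≤⇔ : ∀ {a c} b → (a + 𝟙 b ≤ c) ⇔ (a ≤ c × (T b → a < c))
+𝟙≤⇔ {a} {c} true  = mk⇔ (λ a+1≤c → ≤-trans (m≤m+n a 1) a+1≤c , λ _ → subst (_≤ c) (+-comm a 1) a+1≤c)
                         (λ (_ , a<c) → subst (_≤ c) (+-comm 1 a) (a<c _))
+𝟙≤⇔ {a} {c} false = mk⇔ (λ a+0≤c → subst (_≤ c) (+-identityʳ a) a+0≤c , λ ())
                         (λ (a≤c , _) → subst (_≤ c) (sym (+-identityʳ a)) a≤c)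

-- Maps and permutations

-- By recursion rather than via Data.Fin.Properties.all?, so that it unfolds along allMaps.
_≗?_ : ∀ {d n} (φ ψ : Fin d → Fin n) → Dec (φ ≗ ψ)
_≗?_ {zero}  φ ψ = yes (λ ())
_≗?_ {suc d} φ ψ = map′ (uncurry ≗-cons) (λ e → e zero , e ∘ suc) (φ zero ≟ ψ zero ×-dec (φ ∘ suc) ≗? (ψ ∘ suc))
  where
  ≗-cons : φ zero ≡ ψ zero → (φ ∘ suc) ≗ (ψ ∘ suc) → φ ≗ ψ
  ≗-cons e₀ e zero    = e₀
  ≗-cons e₀ e (suc i) = e i

sumOver-allMaps-suc : ∀ {d n} (w : (Fin (suc d) → Fin n) → ℕ) →
                      sumOver w (allMaps (suc d) n) ≡ ∑[ c < n ] ∑[ φ ∈ allMaps d n ] w (consF c φ)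
sumOver-allMaps-suc {d} {n} w = begin
  sumOver w (concatMap (λ c → map (consF c) (allMaps d n)) (allFin n))
    ≡⟨ sumOver-concatMap w _ (allFin n) ⟩
  ∑[ c ∈ allFin n ] sumOver w (map (consF c) (allMaps d n))
    ≡⟨ sumOver-cong (λ c → sumOver-map w (consF c) (allMaps d n)) (allFin n) ⟩
  ∑[ c ∈ allFin n ] ∑[ φ ∈ allMaps d n ] w (consF c φ)
    ≡⟨ sumOver-allFin (λ c → ∑[ φ ∈ allMaps d n ] w (consF c φ)) ⟩
  ∑[ c < n ] ∑[ φ ∈ allMaps d n ] w (consF c φ) ∎
  where open ≡-Reasoning

allMaps-exact : ∀ d n (ψ : Fin d → Fin n) → ∑[ φ ∈ allMaps d n ] 𝟙 (does (φ ≗? ψ)) ≡ 1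
allMaps-exact zero    n ψ = refl
allMaps-exact (suc d) n ψ = begin
  ∑[ φ ∈ allMaps (suc d) n ] 𝟙 (does (φ ≗? ψ))
    ≡⟨ sumOver-allMaps-suc (λ φ → 𝟙 (does (φ ≗? ψ))) ⟩
  ∑[ c < n ] ∑[ φ ∈ allMaps d n ] 𝟙 (does (c ≟ ψ zero) ∧ does (φ ≗? (ψ ∘ suc)))
    ≡⟨ sum-cong-≗ (λ c → trans (sumOver-cong (λ φ → 𝟙-∧ (does (c ≟ ψ zero)) _) (allMaps d n))
                               (sumOver-*ˡ (𝟙 (does (c ≟ ψ zero))) (λ φ → 𝟙 (does (φ ≗? (ψ ∘ suc)))) (allMaps d n))) ⟩
  ∑[ c < n ] (𝟙 (does (c ≟ ψ zero)) * ∑[ φ ∈ allMaps d n ] 𝟙 (does (φ ≗? (ψ ∘ suc))))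
    ≡⟨ ∑-indicator (ψ zero) _ ⟩
  ∑[ φ ∈ allMaps d n ] 𝟙 (does (φ ≗? (ψ ∘ suc)))
    ≡⟨ allMaps-exact d n (ψ ∘ suc) ⟩
  1 ∎
  where open ≡-Reasoning

module _ {d n : ℕ} where

  private
    Maps : Set
    Maps = Fin d → Fin n

  allMaps-sift : (f : Maps → ℕ) → (∀ {φ ψ} → φ ≗ ψ → f φ ≡ f ψ) →
                 ∀ ψ → ∑[ φ ∈ allMaps d n ] (𝟙 (does (φ ≗? ψ)) * f φ) ≡ f ψ
  allMaps-sift f f-cong ψ = begin
    ∑[ φ ∈ allMaps d n ] (𝟙 (does (φ ≗? ψ)) * f φ)  ≡⟨ sumOver-cong at-ψ (allMaps d n) ⟩
    ∑[ φ ∈ allMaps d n ] (𝟙 (does (φ ≗? ψ)) * f ψ)  ≡⟨ sumOver-*ʳ (f ψ) _ (allMaps d n) ⟩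
    ∑[ φ ∈ allMaps d n ] 𝟙 (does (φ ≗? ψ)) * f ψ    ≡⟨ cong (_* f ψ) (allMaps-exact d n ψ) ⟩
    1 * f ψ                                          ≡⟨ *-identityˡ (f ψ) ⟩
    f ψ ∎
    where
    open ≡-Reasoning
    at-ψ : ∀ φ → 𝟙 (does (φ ≗? ψ)) * f φ ≡ 𝟙 (does (φ ≗? ψ)) * f ψ
    at-ψ φ with φ ≗? ψ
    ... | yes φ≗ψ = cong (1 *_) (f-cong φ≗ψ)
    ... | no  _   = refl

  sumOver-allMaps-precompose : (σ : Permutation′ d) (w : Maps → ℕ) → (∀ {φ ψ} → φ ≗ ψ → w φ ≡ w ψ) →
                               ∑[ φ ∈ allMaps d n ] w (φ ∘ (σ ⟨$⟩ʳ_)) ≡ sumOver w (allMaps d n)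
  sumOver-allMaps-precompose σ w w-cong = begin
    ∑[ φ ∈ M ] w (φ ∘ (σ ⟨$⟩ʳ_))
      ≡⟨ sumOver-cong (λ φ → sym (allMaps-sift w w-cong (φ ∘ (σ ⟨$⟩ʳ_)))) M ⟩
    ∑[ φ ∈ M ] ∑[ ψ ∈ M ] (𝟙 (does (ψ ≗? (φ ∘ (σ ⟨$⟩ʳ_)))) * w ψ)
      ≡⟨ sumOver-comm _ M M ⟩
    ∑[ ψ ∈ M ] ∑[ φ ∈ M ] (𝟙 (does (ψ ≗? (φ ∘ (σ ⟨$⟩ʳ_)))) * w ψ)
      ≡⟨ sumOver-cong (λ ψ → sumOver-cong (λ φ → cong (λ b → 𝟙 b * w ψ) (does-⇔ (transposed φ ψ) (ψ ≗? _) (φ ≗? _))) M) M ⟩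
    ∑[ ψ ∈ M ] ∑[ φ ∈ M ] (𝟙 (does (φ ≗? (ψ ∘ (σ ⟨$⟩ˡ_)))) * w ψ)
      ≡⟨ sumOver-cong (λ ψ → allMaps-sift (λ _ → w ψ) (λ _ → refl) (ψ ∘ (σ ⟨$⟩ˡ_))) M ⟩
    ∑[ ψ ∈ M ] w ψ ∎
    where
    open ≡-Reasoning
    M : List (Fin d → Fin n)
    M = allMaps d n
    transposed : ∀ φ ψ → (ψ ≗ φ ∘ (σ ⟨$⟩ʳ_)) ⇔ (φ ≗ ψ ∘ (σ ⟨$⟩ˡ_))
    transposed φ ψ = mk⇔
      (λ e i → trans (cong φ (sym (inverseʳ σ))) (sym (e (σ ⟨$⟩ˡ i))))
      (λ e i → trans (cong ψ (sym (inverseˡ σ))) (sym (e (σ ⟨$⟩ʳ i))))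

injective⇒surjective : ∀ {d} {p : Fin d → Fin d} → Injective _≡_ _≡_ p → ∀ y → ∃ λ x → p x ≡ y
injective⇒surjective {suc d} {p} inj y with any? (λ x → p x ≟ y)
... | yes found  = found
... | no missing = ⊥-elim (1+n≰n (injective⇒≤ punchOut-injective′))
  where
  y≢p : ∀ x → y ≢ p x
  y≢p x y≡px = missing (x , sym y≡px)
  punchOut-injective′ : Injective _≡_ _≡_ (λ x → punchOut (y≢p x))
  punchOut-injective′ e = inj (punchOut-injective (y≢p _) (y≢p _) e)

injective⇒permutation : ∀ {d} (p : Fin d → Fin d) → Injective _≡_ _≡_ p → Permutation′ d
injective⇒permutation {d} p inj = permutation p (proj₁ ∘ surj) (proj₂ ∘ surj) (λ x → inj (proj₂ (surj (p x))))
  where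
  surj : ∀ y → ∃ λ x → p x ≡ y
  surj = injective⇒surjective inj

permutation-injective : ∀ {d} (π : Permutation′ d) → Injective _≡_ _≡_ (π ⟨$⟩ʳ_)
permutation-injective π e = trans (sym (inverseˡ π)) (trans (cong (π ⟨$⟩ˡ_) e) (inverseˡ π))

isInjective⇔Injective : ∀ {d} (p : Fin d → Fin d) → T (isInjective p) ⇔ Injective _≡_ _≡_ p
isInjective⇔Injective {d} p = mk⇔
  (λ t {x} {y} e → to T-== (to T-→ (to (T-allB-allFin² rows) t x y) (from T-== e)))
  (λ inj → from (T-allB-allFin² rows) (λ x y → from T-→ (from T-== ∘ inj ∘ to T-==)))
  where
  open Equivalence
  rows : Fin d → Fin d → Bool
  rows x y = not (p x == p y) ∨ (x == y)

∈-perms⇒injective : ∀ {d} {p : Fin d → Fin d} → p ∈ perms d → Injective _≡_ _≡_ p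
∈-perms⇒injective {d} {p} p∈ = Equivalence.to (isInjective⇔Injective p) (proj₂ (∈-filter⁻ (T? ∘ isInjective) {xs = allMaps d d} p∈))

-- Proper colourings

Proper : ∀ {d n} → SimpleGraph d → (Fin d → Fin n) → Set
Proper {d} G φ = ∀ u v → T (adj G u v) → φ u ≢ φ v

isProper⇔Proper : ∀ {d n} (G : SimpleGraph d) (φ : Fin d → Fin n) → T (isProper G φ) ⇔ Proper G φ
isProper⇔Proper {d} G φ = mk⇔
  (λ t u v a e → to T-not (to T-→ (to (T-allB-allFin² rows) t u v) a) (from T-== e))
  (λ pr → from (T-allB-allFin² rows) (λ u v → from T-→ (λ a → from T-not (pr u v a ∘ to T-==))))
  where
  open Equivalence
  rows : Fin d → Fin d → Bool
  rows x y = not (adj G x y) ∨ not (φ x == φ y)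

module _ {d n : ℕ} (G : SimpleGraph d) where

  isProper-cong : {φ ψ : Fin d → Fin n} → φ ≗ ψ → isProper G φ ≡ isProper G ψ
  isProper-cong {φ} {ψ} φ≗ψ = does-⇔ (mk⇔ (transport φ≗ψ) (transport (sym ∘ φ≗ψ))) (T? _) (T? _)
    where
    transport : ∀ {φ ψ : Fin d → Fin n} → φ ≗ ψ → T (isProper G φ) → T (isProper G ψ)
    transport {φ} {ψ} φ≗ψ t = Equivalence.from (isProper⇔Proper G ψ) λ u v a e →
      Equivalence.to (isProper⇔Proper G φ) t u v a (trans (φ≗ψ u) (trans e (sym (φ≗ψ v))))

  isProper-relabel : (σ : Permutation′ d) (φ : Fin d → Fin n) →
                     isProper (relabel G σ) φ ≡ isProper G (φ ∘ (σ ⟨$⟩ˡ_))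
  isProper-relabel σ φ = does-⇔ (mk⇔ to from) (T? _) (T? _)
    where
    to : T (isProper (relabel G σ) φ) → T (isProper G (φ ∘ (σ ⟨$⟩ˡ_)))
    to t = Equivalence.from (isProper⇔Proper G (φ ∘ (σ ⟨$⟩ˡ_))) λ u v a →
      Equivalence.to (isProper⇔Proper (relabel G σ) φ) t (σ ⟨$⟩ˡ u) (σ ⟨$⟩ˡ v)
        (subst₂ (λ x y → T (adj G x y)) (sym (inverseʳ σ)) (sym (inverseʳ σ)) a)
    from : T (isProper G (φ ∘ (σ ⟨$⟩ˡ_))) → T (isProper (relabel G σ) φ)
    from t = Equivalence.from (isProper⇔Proper (relabel G σ) φ) λ x y a e →
      Equivalence.to (isProper⇔Proper G (φ ∘ (σ ⟨$⟩ˡ_))) t (σ ⟨$⟩ʳ x) (σ ⟨$⟩ʳ y) a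
        (trans (cong φ (inverseˡ σ)) (trans e (sym (cong φ (inverseˡ σ)))))

χ-relabel : ∀ {d} (G : SimpleGraph d) (σ : Permutation′ d) n → χ (relabel G σ) n ≡ χ G n
χ-relabel {d} G σ n = begin
  χ (relabel G σ) n
    ≡⟨ length-filter≡sumOver (T? ∘ isProper (relabel G σ)) (allMaps d n) ⟩
  ∑[ φ ∈ allMaps d n ] 𝟙 (isProper (relabel G σ) φ)
    ≡⟨ sumOver-cong (cong 𝟙 ∘ isProper-relabel G σ) (allMaps d n) ⟩
  ∑[ φ ∈ allMaps d n ] 𝟙 (isProper G (φ ∘ (σ ⟨$⟩ˡ_)))
    ≡⟨ sumOver-allMaps-precompose (flip σ) (𝟙 ∘ isProper G) (cong 𝟙 ∘ isProper-cong G) ⟩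
  ∑[ φ ∈ allMaps d n ] 𝟙 (isProper G φ)
    ≡⟨ length-filter≡sumOver (T? ∘ isProper G) (allMaps d n) ⟨
  χ G n ∎
  where open ≡-Reasoning

-- Longest paths and cuts

⨆-upper : ∀ {d} (f : Fin d → ℕ) i → f i ≤ ⨆ f
⨆-upper f zero    = m≤m⊔n _ _
⨆-upper f (suc i) = ≤-trans (⨆-upper (f ∘ suc) i) (m≤n⊔m (f zero) _)

⨆-least : ∀ {d b} (f : Fin d → ℕ) → (∀ i → f i ≤ b) → ⨆ f ≤ b
⨆-least {zero}  f f≤b = z≤n
⨆-least {suc d} f f≤b = ⊔-lub (f≤b zero) (⨆-least (f ∘ suc) (f≤b ∘ suc))

foldr-⊔-upper : ∀ {m ns} → m ∈ ns → m ≤ foldr _⊔_ 0 ns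
foldr-⊔-upper {ns = n ∷ ns} (here refl) = m≤m⊔n n _
foldr-⊔-upper {ns = n ∷ ns} (there m∈) = ≤-trans (foldr-⊔-upper m∈) (m≤n⊔m n _)

foldr-⊔-least : ∀ {b ns} → All (_≤ b) ns → foldr _⊔_ 0 ns ≤ b
foldr-⊔-least []         = z≤n
foldr-⊔-least (n≤b ∷ ns) = ⊔-lub n≤b (foldr-⊔-least ns)

foldr-⊔-attained : ∀ ns → foldr _⊔_ 0 ns ≡ 0 ⊎ foldr _⊔_ 0 ns ∈ ns
foldr-⊔-attained []       = inj₁ refl
foldr-⊔-attained (n ∷ ns) with ⊔-sel n (foldr _⊔_ 0 ns) | foldr-⊔-attained ns
... | inj₁ ≡n | _         = inj₂ (here ≡n)
... | inj₂ ≡m | inj₁ ≡0   = inj₁ (trans ≡m ≡0)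
... | inj₂ ≡m | inj₂ m∈ns = inj₂ (there (subst (_∈ ns) (sym ≡m) m∈ns))

∈-subs⇔⊆ : ∀ {A : Set} {xs ys : List A} → xs ∈ subs ys ⇔ xs ⊆ ys
∈-subs⇔⊆ = mk⇔ (to _) from
  where
  to : ∀ {A : Set} {xs : List A} ys → xs ∈ subs ys → xs ⊆ ys
  to []       (here refl) = []
  to (y ∷ ys) xs∈ with ∈-++⁻ (map (y ∷_) (subs ys)) xs∈
  ... | inj₁ xs∈′ with ∈-map⁻ (y ∷_) xs∈′
  ...   | _ , xs′∈ , refl = refl ∷ to ys xs′∈
  to (y ∷ ys) xs∈ | inj₂ xs∈′ = y ∷ʳ to ys xs∈′
  from : ∀ {A : Set} {xs ys : List A} → xs ⊆ ys → xs ∈ subs ys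
  from []                  = here refl
  from (_∷ʳ_ {ys = ys} y τ) = ∈-++⁺ʳ (map (y ∷_) (subs ys)) (from τ)
  from (refl ∷ τ)          = ∈-++⁺ˡ (∈-map⁺ _ (from τ))

module _ {A : Set} {R : A → A → Set} where

  AllPairs-resp-⊆ : ∀ {xs ys} → xs ⊆ ys → AllPairs R ys → AllPairs R xs
  AllPairs-resp-⊆ []       []       = []
  AllPairs-resp-⊆ (y ∷ʳ τ) (_ ∷ rs) = AllPairs-resp-⊆ τ rs
  AllPairs-resp-⊆ (refl ∷ τ) (r ∷ rs) = All-resp-⊆ τ r ∷ AllPairs-resp-⊆ τ rs

  AllPairs-∷ʳ⁺ : ∀ {xs x} → AllPairs R xs → All (λ y → R y x) xs → AllPairs R (xs ++ [ x ])
  AllPairs-∷ʳ⁺ rs ys<x = AllPairs.++⁺ rs ([] ∷ []) (All.map (_∷ []) ys<x)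

  AllPairs-∷ʳ⁻ : ∀ {xs x} → AllPairs R (xs ++ [ x ]) → AllPairs R xs × All (λ y → R y x) xs
  AllPairs-∷ʳ⁻ {[]}     _        = [] , []
  AllPairs-∷ʳ⁻ {y ∷ xs} (r ∷ rs) =
    let (rs′ , xs<x) = AllPairs-∷ʳ⁻ rs ; (r′ , y<x) = ∷ʳ⁻ r in (r′ ∷ rs′) , (y<x ∷ xs<x)

  ascending-⊆ : (∀ {x} → ¬ R x x) → (∀ {x y z} → R x y → R y z → R x z) →
                ∀ {xs ys} → AllPairs R xs → AllPairs R ys → All (_∈ ys) xs → xs ⊆ ys
  ascending-⊆ irr tr {[]}     _ _ _ = minimum _
  ascending-⊆ irr tr {x ∷ xs} {y ∷ ys} (x<xs ∷ xs↑) (y<ys ∷ ys↑) (here refl ∷ xs∈) =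
    refl ∷ ascending-⊆ irr tr xs↑ ys↑ (All.zipWith (λ (x<z , z∈) → drop-head z∈ x<z) (x<xs , xs∈))
    where
    drop-head : ∀ {z} → z ∈ x ∷ ys → R x z → z ∈ ys
    drop-head (here refl) x<x = ⊥-elim (irr x<x)
    drop-head (there z∈)  _   = z∈
  ascending-⊆ irr tr {x ∷ xs} {y ∷ ys} (x<xs ∷ xs↑) (y<ys ∷ ys↑) (there x∈ys ∷ xs∈) =
    y ∷ʳ ascending-⊆ irr tr (x<xs ∷ xs↑) ys↑ (x∈ys ∷ All.zipWith (λ (x<z , z∈) → drop-head z∈ x<z) (x<xs , xs∈))
    where
    y<x : R y x
    y<x = All.lookup y<ys x∈ys
    drop-head : ∀ {z} → z ∈ y ∷ ys → R x z → z ∈ ys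
    drop-head (here refl) x<y = ⊥-elim (irr (tr y<x x<y))
    drop-head (there z∈)  _   = z∈

isPath-∷ʳ : ∀ {d} (G : SimpleGraph d) xs a b →
            isPath G ((xs ++ [ a ]) ++ [ b ]) ≡ isPath G (xs ++ [ a ]) ∧ adj G a b
isPath-∷ʳ G []           a b = ∧-identityʳ (adj G a b)
isPath-∷ʳ G (x ∷ [])     a b = trans (cong (adj G x a ∧_) (∧-identityʳ (adj G a b)))
                                     (cong (_∧ adj G a b) (sym (∧-identityʳ (adj G x a))))
isPath-∷ʳ G (x ∷ y ∷ xs) a b = trans (cong (adj G x y ∧_) (isPath-∷ʳ G (y ∷ xs) a b))
                                     (sym (∧-assoc (adj G x y) _ _))

infix 4 _⋖_
_⋖_ : ∀ {d} → Fin d → Fin d → Set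
i ⋖ k = toℕ k ≡ suc (toℕ i)

⋖⇒< : ∀ {d} {i k : Fin d} → i ⋖ k → i Fin.< k
⋖⇒< i⋖k = ≤-reflexive (sym i⋖k)

⋖⇒≢ : ∀ {d} {i k : Fin d} → i ⋖ k → i ≢ k
⋖⇒≢ i⋖k refl = 1+n≢n (sym i⋖k)

⋖-induction : ∀ {d} (R : Fin d → Fin d → Set) →
              (∀ {i j k} → i Fin.< j → j Fin.< k → R i j → R j k → R i k) →
              (∀ {i k} → i ⋖ k → R i k) →
              ∀ {i k} → i Fin.< k → R i k
⋖-induction {d} R R-trans R-⋖ {i} i<k = go _ _ (sym (proj₂ (m≤n⇒∃[o]m+o≡n i<k)))
  where
  go : ∀ t k → toℕ k ≡ suc (toℕ i + t) → R i k
  go zero    k k≡ = R-⋖ (trans k≡ (cong suc (+-identityʳ _)))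
  go (suc t) k k≡ = R-trans i<j j<k (go t j (toℕ-fromℕ< j<d)) (R-⋖ j⋖k)
    where
    k≡1+j : toℕ k ≡ suc (suc (toℕ i + t))
    k≡1+j = trans k≡ (cong suc (+-suc (toℕ i) t))
    j<d : suc (toℕ i + t) < d
    j<d = <-≤-trans (≤-reflexive (sym k≡1+j)) (<⇒≤ (toℕ<n k))
    j : Fin d
    j = fromℕ< j<d
    j⋖k : j ⋖ k
    j⋖k = trans k≡1+j (cong suc (sym (toℕ-fromℕ< j<d)))
    i<j : i Fin.< j
    i<j = subst (toℕ i <_) (sym (toℕ-fromℕ< j<d)) (s≤s (m≤m+n (toℕ i) t))
    j<k : j Fin.< k
    j<k = ⋖⇒< j⋖k

-- cutAt G p k tells whether the paper's cut k separates positions k - 1 and k (counting from 0);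
-- the cut 0 imposes no strict ascent, so cutAt is false at position zero.
cutAt : ∀ {d} → SimpleGraph d → (Fin d → Fin d) → Fin d → Bool
cutAt G p zero    = false
cutAt G p (suc j) = isCut G p (suc (toℕ j))

module LongestPath {d : ℕ} (G : SimpleGraph d) (p : Fin d → Fin d) where

  PathTo : Fin d → List (Fin d) → Set
  PathTo k s = AllPairs Fin._<_ s × All (Fin._< k) s × T (isPath G (map p (s ++ [ k ])))

  private
    earlier : Fin d → List (Fin d)
    earlier k = filter (λ i → toℕ i <? toℕ k) (allFin d)

    candidates : Fin d → List (List (Fin d))
    candidates k = filter (λ s → T? (isPath G (map p (s ++ [ k ])))) (subs (earlier k))

    ⊆-earlier⇔ : ∀ {k s} → s ⊆ earlier k ⇔ (AllPairs Fin._<_ s × All (Fin._< k) s)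
    ⊆-earlier⇔ {k} = mk⇔
      (λ τ → AllPairs-resp-⊆ τ earlier-ascending , All-resp-⊆ τ (all-filter (λ i → toℕ i <? toℕ k) (allFin d)))
      (λ (s↑ , s<k) → ascending-⊆ (<-irrefl refl) <-trans s↑ earlier-ascending
                        (All.map (λ {i} i<k → ∈-filter⁺ (λ i → toℕ i <? toℕ k) (∈-allFin i) i<k) s<k))
      where
      earlier-ascending : AllPairs Fin._<_ (earlier k)
      earlier-ascending = AllPairs.filter⁺ (λ i → toℕ i <? toℕ k) (AllPairs.tabulate⁺-< (λ i<j → i<j))

    ∈-candidates⇔ : ∀ {k s} → s ∈ candidates k ⇔ PathTo k s
    ∈-candidates⇔ {k} {s} = mk⇔
      (λ s∈ → let (s∈subs , path) = ∈-filter⁻ (λ s → T? (isPath G (map p (s ++ [ k ])))) s∈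
                  (s↑ , s<k) = Equivalence.to ⊆-earlier⇔ (Equivalence.to ∈-subs⇔⊆ s∈subs)
              in s↑ , s<k , path)
      (λ (s↑ , s<k , path) → ∈-filter⁺ (λ s → T? (isPath G (map p (s ++ [ k ]))))
                               (Equivalence.from ∈-subs⇔⊆ (Equivalence.from ⊆-earlier⇔ (s↑ , s<k))) path)

  ell-upper : ∀ {k s} → PathTo k s → length s ≤ ell G p k
  ell-upper v = foldr-⊔-upper (∈-map⁺ length (Equivalence.from ∈-candidates⇔ v))

  ell-least : ∀ {k b} → (∀ s → PathTo k s → length s ≤ b) → ell G p k ≤ b
  ell-least h = foldr-⊔-least (All-map⁺ (All.tabulate (λ s∈ → h _ (Equivalence.to ∈-candidates⇔ s∈))))

  ell-attained : ∀ k → ∃ λ s → PathTo k s × length s ≡ ell G p k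
  ell-attained k with foldr-⊔-attained (map length (candidates k))
  ... | inj₁ ell≡0 = [] , ([] , [] , _) , sym ell≡0
  ... | inj₂ ell∈ with ∈-map⁻ length ell∈
  ...   | s , s∈ , ell≡ = s , Equivalence.to ∈-candidates⇔ s∈ , sym ell≡

  PathTo-∷ʳ⇔ : ∀ {i k s} → PathTo k (s ++ [ i ]) ⇔ (PathTo i s × i Fin.< k × T (adj G (p i) (p k)))
  PathTo-∷ʳ⇔ {i} {k} {s} = mk⇔
    (λ (s↑ , s<k , path) →
      let (s↑′ , s<i) = AllPairs-∷ʳ⁻ s↑ ; (_ , i<k) = ∷ʳ⁻ s<k
          (path′ , a) = Equivalence.to T-∧ (subst T path≡ path)
      in (s↑′ , s<i , path′) , i<k , a)
    (λ ((s↑ , s<i , path) , i<k , a) →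
      AllPairs-∷ʳ⁺ s↑ s<i , ∷ʳ⁺ (All.map (λ j<i → <-trans j<i i<k) s<i) i<k ,
      subst T (sym path≡) (Equivalence.from T-∧ (path , a)))
    where
    path≡ : isPath G (map p ((s ++ [ i ]) ++ [ k ])) ≡ isPath G (map p (s ++ [ i ])) ∧ adj G (p i) (p k)
    path≡ = begin
      isPath G (map p ((s ++ [ i ]) ++ [ k ]))
        ≡⟨ cong (isPath G) (trans (map-++ p (s ++ [ i ]) [ k ]) (cong (_++ [ p k ]) (map-++ p s [ i ]))) ⟩
      isPath G ((map p s ++ [ p i ]) ++ [ p k ])
        ≡⟨ isPath-∷ʳ G (map p s) (p i) (p k) ⟩
      isPath G (map p s ++ [ p i ]) ∧ adj G (p i) (p k)
        ≡⟨ cong (λ q → isPath G q ∧ adj G (p i) (p k)) (map-++ p s [ i ]) ⟨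
      isPath G (map p (s ++ [ i ])) ∧ adj G (p i) (p k) ∎
      where open ≡-Reasoning

  ell-increasing : ∀ {i k} → i Fin.< k → T (adj G (p i) (p k)) → ell G p i < ell G p k
  ell-increasing {i} {k} i<k a with ell-attained i
  ... | s , v , len≡ell = subst (_≤ ell G p k) length-s∷ʳi (ell-upper (Equivalence.from PathTo-∷ʳ⇔ (v , i<k , a)))
    where
    length-s∷ʳi : length (s ++ [ i ]) ≡ suc (ell G p i)
    length-s∷ʳi = trans (length-++ s) (trans (+-comm (length s) 1) (cong suc len≡ell))

  viaPredecessor : Fin d → Fin d → ℕ
  viaPredecessor k i = if (toℕ i <ᵇ toℕ k) ∧ adj G (p i) (p k) then suc (ell G p i) else 0

  viaPredecessor-edge : ∀ {i k} → i Fin.< k → T (adj G (p i) (p k)) → viaPredecessor k i ≡ suc (ell G p i)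
  viaPredecessor-edge {i} i<k a =
    cong (λ b → if b then suc (ell G p i) else 0) (Equivalence.to T-≡ (Equivalence.from T-∧ (<⇒<ᵇ i<k , a)))

  ell-rec : ∀ k → ell G p k ≡ ⨆ (viaPredecessor k)
  ell-rec k = ≤-antisym (ell-least path≤⨆) (⨆-least (viaPredecessor k) viaPredecessor≤ell)
    where
    viaPredecessor≤ell : ∀ i → viaPredecessor k i ≤ ell G p k
    viaPredecessor≤ell i with (toℕ i <ᵇ toℕ k) ∧ adj G (p i) (p k) in eq
    ... | false = z≤n
    ... | true  = let (i<k , a) = Equivalence.to T-∧ (subst T (sym eq) _) in ell-increasing (<ᵇ⇒< _ _ i<k) a

    path≤⨆ : ∀ s → PathTo k s → length s ≤ ⨆ (viaPredecessor k)
    path≤⨆ s v with initLast s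
    ... | []       = z≤n
    ... | s′ ∷ʳ′ i with Equivalence.to PathTo-∷ʳ⇔ v
    ...   | v′ , i<k , a = begin
      length (s′ ++ [ i ])   ≡⟨ trans (length-++ s′) (+-comm (length s′) 1) ⟩
      suc (length s′)        ≤⟨ s≤s (ell-upper v′) ⟩
      suc (ell G p i)        ≡⟨ viaPredecessor-edge i<k a ⟨
      viaPredecessor k i     ≤⟨ ⨆-upper (viaPredecessor k) i ⟩
      ⨆ (viaPredecessor k)   ∎
      where open ≤-Reasoning

  cutAt⇔ : ∀ {i k} → i ⋖ k → T (cutAt G p k) ⇔ ×-Lex _≡_ _<_ _<_ (ell G p i , toℕ (p i)) (ell G p k , toℕ (p k))
  cutAt⇔ {i} {k@(suc _)} i⋖k = mk⇔ (Equivalence.to T-lex ∘ subst T cut≡) (subst T (sym cut≡) ∘ Equivalence.from T-lex)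
    where
    cut≡ : isCut G p (toℕ k) ≡ (ell G p i <ᵇ ell G p k) ∨ ((ell G p i ≡ᵇ ell G p k) ∧ (toℕ (p i) <ᵇ toℕ (p k)))
    cut≡ = trans (cong (isCut G p) i⋖k) (go (toℕ i) refl)
      where
      go : ∀ j → j ≡ toℕ i →
           isCut G p (suc j) ≡ (ell G p i <ᵇ ell G p k) ∨ ((ell G p i ≡ᵇ ell G p k) ∧ (toℕ (p i) <ᵇ toℕ (p k)))
      go j j≡i with j <? d | suc j <? d
      ... | yes j<d | yes 1+j<d =
        cong₂ (λ x y → (ell G p x <ᵇ ell G p y) ∨ ((ell G p x ≡ᵇ ell G p y) ∧ (toℕ (p x) <ᵇ toℕ (p y))))
              (toℕ-injective (trans (toℕ-fromℕ< j<d) j≡i))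
              (toℕ-injective (trans (toℕ-fromℕ< 1+j<d) (trans (cong suc j≡i) (sym i⋖k))))
      ... | no j≮d | _ = ⊥-elim (j≮d (subst (_< d) (sym j≡i) (toℕ<n i)))
      ... | yes _  | no 1+j≮d = ⊥-elim (1+j≮d (subst (_< d) (trans i⋖k (cong suc (sym j≡i))) (toℕ<n k)))

-- Rising sequences

isRising : ∀ {d n} → ℕ → (Fin d → Bool) → (Fin d → Fin n) → Bool
isRising {zero}  lo strict x = true
isRising {suc d} lo strict x = (lo + 𝟙 (strict zero) ≤ᵇ toℕ (x zero)) ∧ isRising (toℕ (x zero)) (strict ∘ suc) (x ∘ suc)

module _ {d n : ℕ} where

  StartsAbove : ℕ → (Fin d → Bool) → (Fin d → Fin n) → Set
  StartsAbove lo strict x = ∀ k → toℕ k ≡ 0 → lo + 𝟙 (strict k) ≤ toℕ (x k)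

  Steps : (Fin d → Bool) → (Fin d → Fin n) → Set
  Steps strict x = ∀ {i k} → i ⋖ k → toℕ (x i) + 𝟙 (strict k) ≤ toℕ (x k)

isRising⇔ : ∀ {d n} lo strict (x : Fin d → Fin n) → T (isRising lo strict x) ⇔ (StartsAbove lo strict x × Steps strict x)
isRising⇔ lo strict x = mk⇔ (to lo strict x) (from lo strict x)
  where
  to : ∀ {d n} lo strict (x : Fin d → Fin n) → T (isRising lo strict x) → StartsAbove lo strict x × Steps strict x
  to {zero}  lo strict x _ = (λ ()) , λ { {()} }
  to {suc d} lo strict x t = first , steps
    where
    head×rest : T (lo + 𝟙 (strict zero) ≤ᵇ toℕ (x zero)) × T (isRising (toℕ (x zero)) (strict ∘ suc) (x ∘ suc))
    head×rest = Equivalence.to T-∧ t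
    tail : StartsAbove (toℕ (x zero)) (strict ∘ suc) (x ∘ suc) × Steps (strict ∘ suc) (x ∘ suc)
    tail = to (toℕ (x zero)) (strict ∘ suc) (x ∘ suc) (proj₂ head×rest)
    first : StartsAbove lo strict x
    first zero _ = ≤ᵇ⇒≤ _ _ (proj₁ head×rest)
    steps : Steps strict x
    steps {zero}  {suc k} i⋖k = proj₁ tail k (suc-injective i⋖k)
    steps {suc i} {suc k} i⋖k = proj₂ tail (suc-injective i⋖k)
  from : ∀ {d n} lo strict (x : Fin d → Fin n) → StartsAbove lo strict x × Steps strict x → T (isRising lo strict x)
  from {zero}  lo strict x _               = _
  from {suc d} lo strict x (first , steps) = Equivalence.from T-∧
    (≤⇒≤ᵇ (first zero refl) ,
     from (toℕ (x zero)) (strict ∘ suc) (x ∘ suc) ((λ k k≡0 → steps {zero} {suc k} (cong suc k≡0)) , (steps ∘ cong suc)))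

isRising-cong : ∀ {d n} lo strict {x y : Fin d → Fin n} → x ≗ y → isRising lo strict x ≡ isRising lo strict y
isRising-cong {zero}  lo strict x≗y = refl
isRising-cong {suc d} lo strict {x} {y} x≗y rewrite x≗y zero = cong (_ ∧_) (isRising-cong (toℕ (y zero)) (strict ∘ suc) (x≗y ∘ suc))

module RisingCount (n : ℕ) where

  rising : ∀ d → (Fin d → Bool) → ℕ → ℕ
  rising d strict lo = ∑[ x ∈ allMaps d n ] 𝟙 (isRising lo strict x)

  risingFrom : ∀ d → (Fin d → Bool) → ℕ → ℕ
  risingFrom d strict l = ∑[ c < n ] (𝟙 (l ≤ᵇ toℕ c) * rising d strict (toℕ c))

  plainSteps : ∀ {d} → (Fin d → Bool) → ℕ
  plainSteps {d} strict = ∑[ i < d ] 𝟙 (not (strict i))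

  plainSteps≤ : ∀ {d} (strict : Fin d → Bool) → plainSteps strict ≤ d
  plainSteps≤ {d} strict = subst (plainSteps strict ≤_) (∑-1 d) (sum-mono-≤ (λ i → 𝟙≤1 (not (strict i))))

  rising-suc : ∀ d strict lo → rising (suc d) strict lo ≡ risingFrom d (strict ∘ suc) (lo + 𝟙 (strict zero))
  rising-suc d strict lo = begin
    rising (suc d) strict lo
      ≡⟨ sumOver-allMaps-suc {d} {n} (λ x → 𝟙 (isRising lo strict x)) ⟩
    ∑[ c < n ] ∑[ x ∈ allMaps d n ] 𝟙 ((lo + 𝟙 (strict zero) ≤ᵇ toℕ c) ∧ isRising (toℕ c) (strict ∘ suc) x)
      ≡⟨ sum-cong-≗ {n} (λ c → trans (sumOver-cong (λ x → 𝟙-∧ (lo + 𝟙 (strict zero) ≤ᵇ toℕ c) _) (allMaps d n))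
                                  (sumOver-*ˡ (𝟙 (lo + 𝟙 (strict zero) ≤ᵇ toℕ c)) _ (allMaps d n))) ⟩
    risingFrom d (strict ∘ suc) (lo + 𝟙 (strict zero)) ∎
    where open ≡-Reasoning

  rising-closed : ∀ d strict lo r → n ≡ suc (r + lo) → rising d strict lo ≡ (r + plainSteps strict) C d
  risingFrom-closed : ∀ d strict r l → n ≡ r + l → risingFrom d strict l ≡ (r + plainSteps strict) C suc d

  rising-closed zero    strict lo r n≡ = refl
  rising-closed (suc d) strict lo r n≡ = trans (rising-suc d strict lo) (by-first-step (strict zero) refl)
    where
    by-first-step : ∀ s → strict zero ≡ s →
                    risingFrom d (strict ∘ suc) (lo + 𝟙 (strict zero)) ≡ (r + plainSteps strict) C suc d
    by-first-step true  strict₀ = begin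
      risingFrom d (strict ∘ suc) (lo + 𝟙 (strict zero))
        ≡⟨ cong (λ s → risingFrom d (strict ∘ suc) (lo + 𝟙 s)) strict₀ ⟩
      risingFrom d (strict ∘ suc) (lo + 1)
        ≡⟨ cong (risingFrom d (strict ∘ suc)) (+-comm lo 1) ⟩
      risingFrom d (strict ∘ suc) (suc lo)
        ≡⟨ risingFrom-closed d (strict ∘ suc) r (suc lo) (trans n≡ (sym (+-suc r lo))) ⟩
      (r + plainSteps (strict ∘ suc)) C suc d
        ≡⟨ cong (λ s → (r + (𝟙 (not s) + plainSteps (strict ∘ suc))) C suc d) strict₀ ⟨
      (r + plainSteps strict) C suc d ∎
      where open ≡-Reasoning
    by-first-step false strict₀ = begin
      risingFrom d (strict ∘ suc) (lo + 𝟙 (strict zero))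
        ≡⟨ cong (λ s → risingFrom d (strict ∘ suc) (lo + 𝟙 s)) strict₀ ⟩
      risingFrom d (strict ∘ suc) (lo + 0)
        ≡⟨ cong (risingFrom d (strict ∘ suc)) (+-identityʳ lo) ⟩
      risingFrom d (strict ∘ suc) lo
        ≡⟨ risingFrom-closed d (strict ∘ suc) (suc r) lo n≡ ⟩
      (suc r + plainSteps (strict ∘ suc)) C suc d
        ≡⟨ cong (_C suc d) (+-suc r _) ⟨
      (r + suc (plainSteps (strict ∘ suc))) C suc d
        ≡⟨ cong (λ s → (r + (𝟙 (not s) + plainSteps (strict ∘ suc))) C suc d) strict₀ ⟨
      (r + plainSteps strict) C suc d ∎
      where open ≡-Reasoning

  risingFrom-closed d strict zero l n≡l = begin
    risingFrom d strict l
      ≡⟨ sum-cong-≗ {n} (λ c → cong (_* rising d strict (toℕ c)) (𝟙-false (<⇒≱ (subst (toℕ c <_) n≡l (toℕ<n c)) ∘ ≤ᵇ⇒≤ l (toℕ c)))) ⟩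
    ∑[ c < n ] 0
      ≡⟨ sum-replicate-zero n ⟩
    0
      ≡⟨ k>n⇒nCk≡0 (s≤s (plainSteps≤ strict)) ⟨
    plainSteps strict C suc d ∎
    where open ≡-Reasoning
  risingFrom-closed d strict (suc r) l n≡ = begin
    risingFrom d strict l
      ≡⟨ sum-cong-≗ {n} (λ c → trans (cong (_* rising d strict (toℕ c)) (𝟙-≤ᵇ-split l (toℕ c)))
                                   (*-distribʳ-+ (rising d strict (toℕ c)) (𝟙 (does (toℕ c ≟ℕ l))) _)) ⟩
    ∑[ c < n ] (𝟙 (does (toℕ c ≟ℕ l)) * rising d strict (toℕ c) + 𝟙 (suc l ≤ᵇ toℕ c) * rising d strict (toℕ c))
      ≡⟨ ∑-distrib-+ {n} (λ c → 𝟙 (does (toℕ c ≟ℕ l)) * rising d strict (toℕ c)) _ ⟩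
    ∑[ c < n ] (𝟙 (does (toℕ c ≟ℕ l)) * rising d strict (toℕ c)) + risingFrom d strict (suc l)
      ≡⟨ cong₂ _+_ (∑-indicatorℕ l (subst (l <_) (sym n≡) (s≤s (m≤n+m l r))) (rising d strict))
                   (risingFrom-closed d strict r (suc l) (trans n≡ (sym (+-suc r l)))) ⟩
    rising d strict l + (r + plainSteps strict) C suc d
      ≡⟨ cong (_+ (r + plainSteps strict) C suc d) (rising-closed d strict l r n≡) ⟩
    (r + plainSteps strict) C d + (r + plainSteps strict) C suc d
      ≡⟨ nCk+nC[k+1]≡[n+1]C[k+1] (r + plainSteps strict) d ⟩
    (suc r + plainSteps strict) C suc d ∎
    where open ≡-Reasoning

-- The sorting permutation of a colouring

keyOrder : StrictTotalOrder 0ℓ 0ℓ 0ℓ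
keyOrder = ×-strictTotalOrder <-strictTotalOrder
             (Flip.strictTotalOrder (×-strictTotalOrder <-strictTotalOrder <-strictTotalOrder))

module Key = StrictTotalOrder keyOrder

module Colouring {d n : ℕ} (G : SimpleGraph d) (φ : Fin d → Fin n) where

  colour : Fin d → ℕ
  colour v = toℕ (φ v)

  below : Fin d → Fin d → Bool
  below u v = adj G u v ∧ (colour u <ᵇ colour v)

  below⇒< : ∀ {u v} → T (below u v) → colour u < colour v
  below⇒< {u} {v} t = <ᵇ⇒< (colour u) (colour v) (proj₂ (Equivalence.to T-∧ t))

  heightStep : (Fin d → ℕ) → Fin d → ℕ
  heightStep g v = ⨆ (λ u → if below u v then suc (g u) else 0)

  heightStep-cong : ∀ {g g′ v} → (∀ u → T (below u v) → g u ≡ g′ u) → heightStep g v ≡ heightStep g′ v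
  heightStep-cong {g} {g′} {v} g≡g′ = ⨆-cong pointwise
    where
    pointwise : ∀ u → (if below u v then suc (g u) else 0) ≡ (if below u v then suc (g′ u) else 0)
    pointwise u with below u v in u↓v
    ... | true  = cong suc (g≡g′ u (subst T (sym u↓v) _))
    ... | false = refl

  IsHeight : (Fin d → ℕ) → Set
  IsHeight g = ∀ v → g v ≡ heightStep g v

  isHeight-unique : ∀ {g g′} → IsHeight g → IsHeight g′ → g ≗ g′
  isHeight-unique {g} {g′} g-height g′-height v = go (suc (colour v)) v ≤-refl
    where
    go : ∀ t v → colour v < t → g v ≡ g′ v
    go (suc t) v v<t = begin
      g v               ≡⟨ g-height v ⟩
      heightStep g v    ≡⟨ heightStep-cong (λ u u↓v → go t u (<-≤-trans (below⇒< u↓v) (≤-pred v<t))) ⟩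
      heightStep g′ v   ≡⟨ g′-height v ⟨
      g′ v              ∎
      where open ≡-Reasoning

  -- Colours strictly increase along `below`, so n rounds of heightStep reach the fixed point.
  heightWithin : ℕ → Fin d → ℕ
  heightWithin zero    v = 0
  heightWithin (suc t) v = heightStep (heightWithin t) v

  heightWithin-stable : ∀ t v → colour v < t → heightWithin t v ≡ heightWithin (suc t) v
  heightWithin-stable (suc t) v v<t =
    heightStep-cong (λ u u↓v → heightWithin-stable t u (<-≤-trans (below⇒< u↓v) (≤-pred v<t)))

  height : Fin d → ℕ
  height = heightWithin n

  height-isHeight : IsHeight height
  height-isHeight v = heightWithin-stable n v (toℕ<n (φ v))

  -- colour ascending, then (height, label) descending
  key : Fin d → ℕ × ℕ × ℕ
  key v = colour v , height v , toℕ v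

  infix 4 _≺_
  _≺_ : Fin d → Fin d → Set
  u ≺ v = key u Key.< key v

  ≺-trans : ∀ {u v w} → u ≺ v → v ≺ w → u ≺ w
  ≺-trans = Key.trans

  ≺-irrefl : ∀ {u} → ¬ (u ≺ u)
  ≺-irrefl = Key.irrefl Key.Eq.refl

  ≺-asym : ∀ {u v} → u ≺ v → ¬ (v ≺ u)
  ≺-asym = Key.asym

  ≺-total : ∀ {u v} → u ≢ v → u ≺ v ⊎ v ≺ u
  ≺-total {u} {v} u≢v with Key.compare (key u) (key v)
  ... | tri< u≺v _ _              = inj₁ u≺v
  ... | tri> _ _ v≺u              = inj₂ v≺u
  ... | tri≈ _ (_ , _ , label≡) _ = ⊥-elim (u≢v (toℕ-injective (sym label≡)))

  ≺⇒colour≤ : ∀ {u v} → u ≺ v → colour u ≤ colour v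
  ≺⇒colour≤ (inj₁ u<v)     = <⇒≤ u<v
  ≺⇒colour≤ (inj₂ (u≡v , _)) = ≤-reflexive u≡v

  rank : Fin d → ℕ
  rank v = ∑[ u < d ] 𝟙 (does (key u Key.<? key v))

  rank-mono : ∀ {u v} → u ≺ v → rank u < rank v
  rank-mono {u} {v} u≺v = sum-mono-< pointwise u at-u
    where
    pointwise : ∀ w → 𝟙 (does (key w Key.<? key u)) ≤ 𝟙 (does (key w Key.<? key v))
    pointwise w with key w Key.<? key u | key w Key.<? key v
    ... | yes w≺u | no w⊀v = ⊥-elim (w⊀v (≺-trans w≺u u≺v))
    ... | yes _   | yes _  = ≤-refl
    ... | no _    | _      = z≤n
    at-u : 𝟙 (does (key u Key.<? key u)) < 𝟙 (does (key u Key.<? key v))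
    at-u rewrite dec-false (key u Key.<? key u) ≺-irrefl | dec-true (key u Key.<? key v) u≺v = s≤s z≤n

  rank<d : ∀ v → rank v < d
  rank<d v = subst (rank v <_) (∑-1 d) (sum-mono-< (λ w → 𝟙≤1 _) v at-v)
    where
    at-v : 𝟙 (does (key v Key.<? key v)) < 1
    at-v rewrite dec-false (key v Key.<? key v) ≺-irrefl = s≤s z≤n

  rank-injective : ∀ {u v} → rank u ≡ rank v → u ≡ v
  rank-injective {u} {v} ranks≡ with u ≟ v
  ... | yes u≡v = u≡v
  ... | no u≢v with ≺-total u≢v
  ...   | inj₁ u≺v = ⊥-elim (<-irrefl ranks≡ (rank-mono u≺v))
  ...   | inj₂ v≺u = ⊥-elim (<-irrefl (sym ranks≡) (rank-mono v≺u))

  Sorted : (Fin d → Fin d) → Set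
  Sorted p = ∀ {i k} → i ⋖ k → p i ≺ p k

  sorted-< : ∀ {p} → Sorted p → ∀ {i k} → i Fin.< k → p i ≺ p k
  sorted-< {p} sorted = ⋖-induction (λ i k → p i ≺ p k) (λ _ _ → ≺-trans) sorted

  sorted-rank : (π : Permutation′ d) → Sorted (π ⟨$⟩ʳ_) → ∀ j → rank (π ⟨$⟩ʳ j) ≡ toℕ j
  sorted-rank π sorted j = begin
    rank (π ⟨$⟩ʳ j)
      ≡⟨ ∑-permute (λ u → 𝟙 (does (key u Key.<? key (π ⟨$⟩ʳ j)))) π ⟩
    ∑[ i < d ] 𝟙 (does (key (π ⟨$⟩ʳ i) Key.<? key (π ⟨$⟩ʳ j)))
      ≡⟨ sum-cong-≗ (λ i → cong 𝟙 (does-⇔ (≺⇔< i) (key (π ⟨$⟩ʳ i) Key.<? key (π ⟨$⟩ʳ j)) (toℕ i <? toℕ j))) ⟩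
    ∑[ i < d ] 𝟙 (does (toℕ i <? toℕ j))
      ≡⟨ ∑-𝟙< j ⟩
    toℕ j ∎
    where
    open ≡-Reasoning
    ≺⇔< : ∀ i → (π ⟨$⟩ʳ i ≺ π ⟨$⟩ʳ j) ⇔ (i Fin.< j)
    ≺⇔< i = mk⇔ to (sorted-< sorted)
      where
      to : π ⟨$⟩ʳ i ≺ π ⟨$⟩ʳ j → i Fin.< j
      to πi≺πj with <-cmp (toℕ i) (toℕ j)
      ... | tri< i<j _ _ = i<j
      ... | tri≈ _ i≡j _ = ⊥-elim (≺-irrefl (subst (λ x → π ⟨$⟩ʳ x ≺ π ⟨$⟩ʳ j) (toℕ-injective i≡j) πi≺πj))
      ... | tri> _ _ j<i = ⊥-elim (≺-asym πi≺πj (sorted-< sorted j<i))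

  sorted-unique : (π π′ : Permutation′ d) → Sorted (π ⟨$⟩ʳ_) → Sorted (π′ ⟨$⟩ʳ_) → ∀ j → π ⟨$⟩ʳ j ≡ π′ ⟨$⟩ʳ j
  sorted-unique π π′ sorted sorted′ j = rank-injective (trans (sorted-rank π sorted j) (sym (sorted-rank π′ sorted′ j)))

  private
    rankFin : Fin d → Fin d
    rankFin v = fromℕ< (rank<d v)

    rankPermutation : Permutation′ d
    rankPermutation = injective⇒permutation rankFin λ {u} {v} e →
      rank-injective (trans (sym (toℕ-fromℕ< (rank<d u))) (trans (cong toℕ e) (toℕ-fromℕ< (rank<d v))))

  sorting : Permutation′ d
  sorting = flip rankPermutation

  rank-sorting : ∀ j → rank (sorting ⟨$⟩ʳ j) ≡ toℕ j
  rank-sorting j = trans (sym (toℕ-fromℕ< (rank<d _))) (cong toℕ (inverseʳ rankPermutation))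

  sorting-sorted : Sorted (sorting ⟨$⟩ʳ_)
  sorting-sorted {i} {k} i⋖k = [ id , not-reversed ]′ (≺-total (⋖⇒≢ i⋖k ∘ permutation-injective sorting))
    where
    not-reversed : sorting ⟨$⟩ʳ k ≺ sorting ⟨$⟩ʳ i → sorting ⟨$⟩ʳ i ≺ sorting ⟨$⟩ʳ k
    not-reversed reversed = ⊥-elim (<-asym (⋖⇒< i⋖k) (subst₂ _<_ (rank-sorting k) (rank-sorting i) (rank-mono reversed)))

  Compatible : (Fin d → Fin d) → Set
  Compatible p = ∀ {i k} → i ⋖ k → colour (p i) ≤ colour (p k) × (T (cutAt G p k) → colour (p i) < colour (p k))

  ColourMonotone : (Fin d → Fin d) → Set
  ColourMonotone p = ∀ {i k} → i Fin.≤ k → colour (p i) ≤ colour (p k)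

  colourMonotone-⋖ : ∀ {p} → (∀ {i k} → i ⋖ k → colour (p i) ≤ colour (p k)) → ColourMonotone p
  colourMonotone-⋖ {p} step {i} {k} i≤k with m≤n⇒m<n∨m≡n i≤k
  ... | inj₁ i<k = ⋖-induction (λ i k → colour (p i) ≤ colour (p k)) (λ _ _ → ≤-trans) step i<k
  ... | inj₂ i≡k = ≤-reflexive (cong (colour ∘ p) (toℕ-injective i≡k))

  module _ (π : Permutation′ d) where

    private
      p π⁻¹ : Fin d → Fin d
      p = π ⟨$⟩ʳ_
      π⁻¹ = π ⟨$⟩ˡ_

      adj-positions : ∀ {u v} → T (adj G u v) → T (adj G (p (π⁻¹ u)) (p (π⁻¹ v)))
      adj-positions = subst₂ (λ x y → T (adj G x y)) (sym (inverseʳ π)) (sym (inverseʳ π))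

      colour-positions : ∀ {u v} → colour u ≡ colour v → colour (p (π⁻¹ u)) ≡ colour (p (π⁻¹ v))
      colour-positions = subst₂ (λ x y → colour x ≡ colour y) (sym (inverseʳ π)) (sym (inverseʳ π))

    open LongestPath G p

    earlier⇔lowerColour : ColourMonotone p → Proper G φ →
                          ∀ {u v} → T (adj G u v) → (π⁻¹ u Fin.< π⁻¹ v) ⇔ (colour u < colour v)
    earlier⇔lowerColour mono proper {u} {v} uv = mk⇔ to from
      where
      mono′ : ∀ {x y} → π⁻¹ x Fin.≤ π⁻¹ y → colour x ≤ colour y
      mono′ = subst₂ (λ x y → colour x ≤ colour y) (inverseʳ π) (inverseʳ π) ∘ mono
      to : π⁻¹ u Fin.< π⁻¹ v → colour u < colour v
      to earlier = ≤∧≢⇒< (mono′ (<⇒≤ earlier)) (proper u v uv ∘ toℕ-injective)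
      from : colour u < colour v → π⁻¹ u Fin.< π⁻¹ v
      from lower with <-cmp (toℕ (π⁻¹ u)) (toℕ (π⁻¹ v))
      ... | tri< earlier _ _ = earlier
      ... | tri≈ _ same _    = ⊥-elim (<⇒≱ lower (mono′ (≤-reflexive (sym same))))
      ... | tri> _ _ later   = ⊥-elim (<⇒≱ lower (mono′ (<⇒≤ later)))

    ell≡height : ColourMonotone p → Proper G φ → ∀ i → ell G p i ≡ height (p i)
    ell≡height mono proper i =
      trans (cong (ell G p) (sym (inverseˡ π))) (isHeight-unique g-isHeight height-isHeight (p i))
      where
      g : Fin d → ℕ
      g v = ell G p (π⁻¹ v)
      g-isHeight : IsHeight g
      g-isHeight v = begin
        ell G p (π⁻¹ v)                             ≡⟨ ell-rec (π⁻¹ v) ⟩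
        ⨆ (viaPredecessor (π⁻¹ v))                  ≡⟨ ⨆-permute (viaPredecessor (π⁻¹ v)) (flip π) ⟩
        ⨆ (λ u → viaPredecessor (π⁻¹ v) (π⁻¹ u))    ≡⟨ ⨆-cong (λ u → cong (λ b → if b then suc (g u) else 0) (edge≡below u)) ⟩
        heightStep g v                              ∎
        where
        open ≡-Reasoning
        edge≡below : ∀ u → ((toℕ (π⁻¹ u) <ᵇ toℕ (π⁻¹ v)) ∧ adj G (p (π⁻¹ u)) (p (π⁻¹ v))) ≡ below u v
        edge≡below u = does-⇔ (mk⇔ fwd bwd) (T? _) (T? _)
          where
          fwd : T ((toℕ (π⁻¹ u) <ᵇ toℕ (π⁻¹ v)) ∧ adj G (p (π⁻¹ u)) (p (π⁻¹ v))) → T (below u v)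
          fwd t = let (earlier , a) = Equivalence.to T-∧ t
                      uv = subst₂ (λ x y → T (adj G x y)) (inverseʳ π) (inverseʳ π) a
                  in Equivalence.from T-∧ (uv , <⇒<ᵇ (Equivalence.to (earlier⇔lowerColour mono proper uv) (<ᵇ⇒< _ _ earlier)))
          bwd : T (below u v) → T ((toℕ (π⁻¹ u) <ᵇ toℕ (π⁻¹ v)) ∧ adj G (p (π⁻¹ u)) (p (π⁻¹ v)))
          bwd t = let (uv , lower) = Equivalence.to T-∧ t
                  in Equivalence.from T-∧ (<⇒<ᵇ (Equivalence.from (earlier⇔lowerColour mono proper uv) (<ᵇ⇒< _ _ lower)) ,
                                           adj-positions uv)

    cut⇔descent : ColourMonotone p → Proper G φ →
                  ∀ {i k} → i ⋖ k → colour (p i) ≡ colour (p k) → T (cutAt G p k) ⇔ (p k ≺ p i)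
    cut⇔descent mono proper {i} {k} i⋖k same = mk⇔ to from
      where
      ell→height : ×-Lex _≡_ _<_ _<_ (ell G p i , toℕ (p i)) (ell G p k , toℕ (p k))
                 ≡ ×-Lex _≡_ _<_ _<_ (height (p i) , toℕ (p i)) (height (p k) , toℕ (p k))
      ell→height = cong₂ (λ a b → ×-Lex _≡_ _<_ _<_ (a , toℕ (p i)) (b , toℕ (p k)))
                         (ell≡height mono proper i) (ell≡height mono proper k)
      to : T (cutAt G p k) → p k ≺ p i
      to cut = inj₂ (sym same , subst (λ A → A) ell→height (Equivalence.to (cutAt⇔ i⋖k) cut))
      from : p k ≺ p i → T (cutAt G p k)
      from (inj₁ lower)         = ⊥-elim (<-irrefl (sym same) lower)
      from (inj₂ (_ , descent)) = Equivalence.from (cutAt⇔ i⋖k) (subst (λ A → A) (sym ell→height) descent)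

    compatible⇒monotone : Compatible p → ColourMonotone p
    compatible⇒monotone compatible = colourMonotone-⋖ (proj₁ ∘ compatible)

    compatible⇒flat : Compatible p → ∀ {i k} → i Fin.< k → colour (p i) ≡ colour (p k) → ell G p k ≤ ell G p i
    compatible⇒flat compatible = ⋖-induction R R-trans R-⋖
      where
      mono : ColourMonotone p
      mono = compatible⇒monotone compatible
      R : Fin d → Fin d → Set
      R i k = colour (p i) ≡ colour (p k) → ell G p k ≤ ell G p i
      R-⋖ : ∀ {i k} → i ⋖ k → R i k
      R-⋖ i⋖k same = ≮⇒≥ λ ell< → <-irrefl same (proj₂ (compatible i⋖k) (Equivalence.from (cutAt⇔ i⋖k) (inj₁ ell<)))
      R-trans : ∀ {i j k} → i Fin.< j → j Fin.< k → R i j → R j k → R i k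
      R-trans {i} {j} {k} i<j j<k Rij Rjk same = ≤-trans (Rjk (trans (sym sameᵢⱼ) same)) (Rij sameᵢⱼ)
        where
        sameᵢⱼ : colour (p i) ≡ colour (p j)
        sameᵢⱼ = ≤-antisym (mono (<⇒≤ i<j)) (subst (colour (p j) ≤_) (sym same) (mono (<⇒≤ j<k)))

    no-flat-edge : Compatible p → ∀ {i k} → i Fin.< k → T (adj G (p i) (p k)) → colour (p i) ≢ colour (p k)
    no-flat-edge compatible i<k a same = <⇒≱ (ell-increasing i<k a) (compatible⇒flat compatible i<k same)

    compatible⇒proper : Compatible p → Proper G φ
    compatible⇒proper compatible u v uv φu≡φv with <-cmp (toℕ (π⁻¹ u)) (toℕ (π⁻¹ v))
    ... | tri< earlier _ _ = no-flat-edge compatible earlier (adj-positions uv) (colour-positions (cong toℕ φu≡φv))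
    ... | tri≈ _ same _    = subst T (irrefl G v) (subst (λ x → T (adj G x v)) u≡v uv)
      where
      u≡v : u ≡ v
      u≡v = trans (sym (inverseʳ π)) (trans (cong p (toℕ-injective same)) (inverseʳ π))
    ... | tri> _ _ later   = no-flat-edge compatible later (adj-positions (subst T (SimpleGraph.sym G u v) uv))
                                          (colour-positions (cong toℕ (sym φu≡φv)))

    compatible⇒sorted : Compatible p → Sorted p
    compatible⇒sorted compatible {i} {k} i⋖k =
      [ inj₁ , sameColour ]′ (m≤n⇒m<n∨m≡n (proj₁ (compatible i⋖k)))
      where
      sameColour : colour (p i) ≡ colour (p k) → p i ≺ p k
      sameColour same = [ id , (λ descent → ⊥-elim (<-irrefl same (proj₂ (compatible i⋖k) (Equivalence.from cut⇔ descent)))) ]′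
                          (≺-total (⋖⇒≢ i⋖k ∘ permutation-injective π))
        where
        cut⇔ : T (cutAt G p k) ⇔ (p k ≺ p i)
        cut⇔ = cut⇔descent (compatible⇒monotone compatible) (compatible⇒proper compatible) i⋖k same

    sorted⇒compatible : Proper G φ → Sorted p → Compatible p
    sorted⇒compatible proper sorted {i} {k} i⋖k = ≺⇒colour≤ (sorted i⋖k) , strict
      where
      strict : T (cutAt G p k) → colour (p i) < colour (p k)
      strict cut = [ id , (λ same → ⊥-elim (≺-asym (sorted i⋖k) (Equivalence.to (cut⇔ same) cut))) ]′
                     (m≤n⇒m<n∨m≡n (≺⇒colour≤ (sorted i⋖k)))
        where
        cut⇔ : colour (p i) ≡ colour (p k) → T (cutAt G p k) ⇔ (p k ≺ p i)
        cut⇔ = cut⇔descent (colourMonotone-⋖ (λ j⋖l → ≺⇒colour≤ (sorted j⋖l))) proper i⋖k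

  isCompatible : (Fin d → Fin d) → Bool
  isCompatible p = isRising 0 (cutAt G p) (φ ∘ p)

  compatible⇔isCompatible : ∀ p → Compatible p ⇔ T (isCompatible p)
  compatible⇔isCompatible p = mk⇔
    (λ compatible → Equivalence.from (isRising⇔ 0 (cutAt G p) (φ ∘ p))
                      (starts , λ {i} {k} i⋖k → Equivalence.from (+𝟙≤⇔ (cutAt G p k)) (compatible i⋖k)))
    (λ rising {i} {k} i⋖k → Equivalence.to (+𝟙≤⇔ (cutAt G p k))
                              (proj₂ (Equivalence.to (isRising⇔ 0 (cutAt G p) (φ ∘ p)) rising) i⋖k))
    where
    starts : StartsAbove 0 (cutAt G p) (φ ∘ p)
    starts zero _ = z≤n

  compatible⇔sorting : Proper G φ → ∀ p → T (isInjective p ∧ isCompatible p) ⇔ (p ≗ (sorting ⟨$⟩ʳ_))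
  compatible⇔sorting proper p = mk⇔ to from
    where
    to : T (isInjective p ∧ isCompatible p) → p ≗ (sorting ⟨$⟩ʳ_)
    to t = let (injective , compatible) = Equivalence.to T-∧ t
               π = injective⇒permutation p (Equivalence.to (isInjective⇔Injective p) injective)
           in sorted-unique π sorting (compatible⇒sorted π (Equivalence.from (compatible⇔isCompatible p) compatible))
                            sorting-sorted
    from : p ≗ (sorting ⟨$⟩ʳ_) → T (isInjective p ∧ isCompatible p)
    from p≗ = Equivalence.from T-∧ (Equivalence.from (isInjective⇔Injective p) injective ,
                                    Equivalence.to (compatible⇔isCompatible p) (sorted⇒compatible π proper sorted))
      where
      injective : Injective _≡_ _≡_ p
      injective {x} {y} px≡py = permutation-injective sorting (trans (sym (p≗ x)) (trans px≡py (p≗ y)))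
      π : Permutation′ d
      π = injective⇒permutation p injective
      sorted : Sorted p
      sorted {i} {k} i⋖k = subst₂ _≺_ (sym (p≗ i)) (sym (p≗ k)) (sorting-sorted i⋖k)

  compatibleCount : ∑[ p ∈ perms d ] 𝟙 (isCompatible p) ≡ 𝟙 (isProper G φ)
  compatibleCount = by-properness (T? (isProper G φ))
    where
    open ≡-Reasoning
    by-properness : Dec (T (isProper G φ)) → ∑[ p ∈ perms d ] 𝟙 (isCompatible p) ≡ 𝟙 (isProper G φ)
    by-properness (yes proper) = begin
      ∑[ p ∈ perms d ] 𝟙 (isCompatible p)
        ≡⟨ sumOver-filter (T? ∘ isInjective) (𝟙 ∘ isCompatible) (allMaps d d) ⟩
      ∑[ p ∈ allMaps d d ] (𝟙 (isInjective p) * 𝟙 (isCompatible p))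
        ≡⟨ sumOver-cong (λ p → trans (sym (𝟙-∧ (isInjective p) (isCompatible p)))
                                      (cong 𝟙 (does-⇔ (compatible⇔sorting proper′ p) (T? _) (p ≗? _)))) (allMaps d d) ⟩
      ∑[ p ∈ allMaps d d ] 𝟙 (does (p ≗? (sorting ⟨$⟩ʳ_)))
        ≡⟨ allMaps-exact d d (sorting ⟨$⟩ʳ_) ⟩
      1
        ≡⟨ 𝟙-true proper ⟨
      𝟙 (isProper G φ) ∎
      where
      proper′ : Proper G φ
      proper′ = Equivalence.to (isProper⇔Proper G φ) proper
    by-properness (no improper) = begin
      ∑[ p ∈ perms d ] 𝟙 (isCompatible p)
        ≡⟨ sumOver-cong-∈ (perms d) (λ p∈ → 𝟙-false (incompatible p∈)) ⟩
      ∑[ p ∈ perms d ] 0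
        ≡⟨ sumOver-zero (perms d) ⟩
      0
        ≡⟨ 𝟙-false improper ⟨
      𝟙 (isProper G φ) ∎
      where
      incompatible : ∀ {p} → p ∈ perms d → ¬ T (isCompatible p)
      incompatible {p} p∈ compatible = improper (Equivalence.from (isProper⇔Proper G φ)
        (compatible⇒proper (injective⇒permutation p (∈-perms⇒injective p∈))
                           (Equivalence.from (compatible⇔isCompatible p) compatible)))

-- The chromatic function as a sum over permutations

χ≡∑rising : ∀ {d} (G : SimpleGraph d) n → χ G n ≡ ∑[ p ∈ perms d ] ∑[ x ∈ allMaps d n ] 𝟙 (isRising 0 (cutAt G p) x)
χ≡∑rising {d} G n = begin
  χ G n
    ≡⟨ length-filter≡sumOver (T? ∘ isProper G) (allMaps d n) ⟩
  ∑[ φ ∈ allMaps d n ] 𝟙 (isProper G φ)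
    ≡⟨ sumOver-cong (λ φ → sym (Colouring.compatibleCount G φ)) (allMaps d n) ⟩
  ∑[ φ ∈ allMaps d n ] ∑[ p ∈ perms d ] 𝟙 (isRising 0 (cutAt G p) (φ ∘ p))
    ≡⟨ sumOver-comm (λ φ p → 𝟙 (isRising 0 (cutAt G p) (φ ∘ p))) (allMaps d n) (perms d) ⟩
  ∑[ p ∈ perms d ] ∑[ φ ∈ allMaps d n ] 𝟙 (isRising 0 (cutAt G p) (φ ∘ p))
    ≡⟨ sumOver-cong-∈ (perms d) (λ {p} p∈ →
         sumOver-allMaps-precompose (injective⇒permutation p (∈-perms⇒injective p∈))
           (λ x → 𝟙 (isRising 0 (cutAt G p) x)) (cong 𝟙 ∘ isRising-cong 0 (cutAt G p))) ⟩
  ∑[ p ∈ perms d ] ∑[ x ∈ allMaps d n ] 𝟙 (isRising 0 (cutAt G p) x) ∎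
  where open ≡-Reasoning

cuts≡ : ∀ {d} (G : SimpleGraph (suc d)) p → cuts G p ≡ suc (∑[ k < suc d ] 𝟙 (cutAt G p k))
cuts≡ {d} G p = trans (length-filter≡sumOver (T? ∘ isCut G p) (upTo (suc d)))
                      (cong suc (sumOver-applyUpTo (𝟙 ∘ isCut G p) suc d))

shifted-binomial : ∀ r e t {D} → e + t ≡ D → (r + e) C D ≡ (if suc t ≤ᵇ suc r then (r ∸ t + D) C D else 0)
shifted-binomial r e t {D} e+t≡D with t ≤? r
... | yes t≤r = begin
  (r + e) C D             ≡⟨ cong (λ x → (x + e) C D) (m∸n+n≡m t≤r) ⟨
  (r ∸ t + t + e) C D     ≡⟨ cong (_C D) (+-assoc (r ∸ t) t e) ⟩
  (r ∸ t + (t + e)) C D   ≡⟨ cong (λ x → (r ∸ t + x) C D) (trans (+-comm t e) e+t≡D) ⟩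
  (r ∸ t + D) C D         ≡⟨ cong (λ b → if b then (r ∸ t + D) C D else 0) (dec-true (suc t ≤? suc r) (s≤s t≤r)) ⟨
  (if suc t ≤ᵇ suc r then (r ∸ t + D) C D else 0) ∎
  where open ≡-Reasoning
... | no t≰r = trans (k>n⇒nCk≡0 r+e<D)
                       (sym (cong (λ b → if b then (r ∸ t + D) C D else 0) (dec-false (suc t ≤? suc r) (t≰r ∘ ≤-pred))))
  where
  r+e<D : r + e < D
  r+e<D = subst (r + e <_) (trans (+-comm t e) e+t≡D) (+-monoˡ-< e (≰⇒> t≰r))

risingCount-closed : ∀ {d} (G : SimpleGraph d) p n →
                     ∑[ x ∈ allMaps d n ] 𝟙 (isRising 0 (cutAt G p) x) ≡ (if cuts G p ≤ᵇ n then (n ∸ cuts G p + d) C d else 0)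
risingCount-closed {zero}  G p n       = refl
risingCount-closed {suc d} G p zero    = sym (cong (λ c → if c ≤ᵇ 0 then (0 ∸ c + suc d) C suc d else 0) (cuts≡ G p))
risingCount-closed {suc d} G p (suc r) = begin
  RisingCount.rising (suc r) (suc d) (cutAt G p) 0
    ≡⟨ RisingCount.rising-closed (suc r) (suc d) (cutAt G p) 0 r (cong suc (sym (+-identityʳ r))) ⟩
  (r + ∑[ k < suc d ] 𝟙 (not (cutAt G p k))) C suc d
    ≡⟨ shifted-binomial r _ _ (∑-𝟙-not+∑-𝟙 (cutAt G p)) ⟩
  (if suc t ≤ᵇ suc r then (r ∸ t + suc d) C suc d else 0)
    ≡⟨ cong (λ c → if c ≤ᵇ suc r then (suc r ∸ c + suc d) C suc d else 0) (cuts≡ G p) ⟨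
  (if cuts G p ≤ᵇ suc r then (suc r ∸ cuts G p + suc d) C suc d else 0) ∎
  where
  open ≡-Reasoning
  t : ℕ
  t = ∑[ k < suc d ] 𝟙 (cutAt G p k)

-- Power series

-- f : ℕ → ℤ stands for Σ f(m) t^m; shift multiplies by t and Δ by 1 - t.
shift : (ℕ → ℤ) → ℕ → ℤ
shift f zero    = + 0
shift f (suc m) = f m

Δ : (ℕ → ℤ) → ℕ → ℤ
Δ f m = f m -ℤ shift f m

shift^ : ℕ → (ℕ → ℤ) → ℕ → ℤ
shift^ zero    f = f
shift^ (suc j) f = shift (shift^ j f)

Δ^ : ℕ → (ℕ → ℤ) → ℕ → ℤ
Δ^ zero    f = f
Δ^ (suc a) f = Δ^ a (Δ f)

shift-cong : ∀ {f g} → f ≗ g → shift f ≗ shift g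
shift-cong f≗g zero    = refl
shift-cong f≗g (suc m) = f≗g m

shift^-cong : ∀ j {f g} → f ≗ g → shift^ j f ≗ shift^ j g
shift^-cong zero    f≗g = f≗g
shift^-cong (suc j) f≗g = shift-cong (shift^-cong j f≗g)

Δ-cong : ∀ {f g} → f ≗ g → Δ f ≗ Δ g
Δ-cong f≗g m = cong₂ _-ℤ_ (f≗g m) (shift-cong f≗g m)

Δ^-cong : ∀ a {f g} → f ≗ g → Δ^ a f ≗ Δ^ a g
Δ^-cong zero    f≗g = f≗g
Δ^-cong (suc a) f≗g = Δ^-cong a (Δ-cong f≗g)

shift^-apply : ∀ j f m → shift^ j f m ≡ (if j ≤ᵇ m then f (m ∸ j) else + 0)
shift^-apply zero    f m       = refl
shift^-apply (suc j) f zero    = refl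
shift^-apply (suc j) f (suc m) = trans (shift^-apply j f m) (cong (λ b → if b then f (m ∸ j) else + 0) (≤ᵇ-suc j))
  where
  ≤ᵇ-suc : ∀ j → (j ≤ᵇ m) ≡ (suc j ≤ᵇ suc m)
  ≤ᵇ-suc zero    = refl
  ≤ᵇ-suc (suc j) = refl

shift^-comm : ∀ j f → shift^ j (shift f) ≗ shift (shift^ j f)
shift^-comm zero    f = λ _ → refl
shift^-comm (suc j) f = shift-cong (shift^-comm j f)

shift^-+ : ∀ j f g m → shift^ j (λ k → f k +ℤ g k) m ≡ shift^ j f m +ℤ shift^ j g m
shift^-+ j f g m = begin
  shift^ j (λ k → f k +ℤ g k) m                                          ≡⟨ shift^-apply j _ m ⟩
  (if j ≤ᵇ m then f (m ∸ j) +ℤ g (m ∸ j) else + 0)                       ≡⟨ split (j ≤ᵇ m) ⟩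
  (if j ≤ᵇ m then f (m ∸ j) else + 0) +ℤ (if j ≤ᵇ m then g (m ∸ j) else + 0) ≡⟨ cong₂ _+ℤ_ (shift^-apply j f m) (shift^-apply j g m) ⟨
  shift^ j f m +ℤ shift^ j g m                                           ∎
  where
  open ≡-Reasoning
  split : ∀ b → (if b then f (m ∸ j) +ℤ g (m ∸ j) else + 0) ≡ (if b then f (m ∸ j) else + 0) +ℤ (if b then g (m ∸ j) else + 0)
  split true  = refl
  split false = refl

shift^-neg : ∀ j f m → shift^ j (λ k → -ℤ f k) m ≡ -ℤ shift^ j f m
shift^-neg j f m = trans (shift^-apply j _ m) (trans (split (j ≤ᵇ m)) (cong -ℤ_ (sym (shift^-apply j f m))))
  where
  split : ∀ b → (if b then -ℤ f (m ∸ j) else + 0) ≡ -ℤ (if b then f (m ∸ j) else + 0)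
  split true  = refl
  split false = refl

Δ-shift : ∀ f → Δ (shift f) ≗ shift (Δ f)
Δ-shift f zero    = refl
Δ-shift f (suc m) = refl

Δ-shift^ : ∀ c f → Δ (shift^ c f) ≗ shift^ c (Δ f)
Δ-shift^ zero    f m = refl
Δ-shift^ (suc c) f m = trans (Δ-shift (shift^ c f) m) (shift-cong (Δ-shift^ c f) m)

Δ^-shift^ : ∀ a c f → Δ^ a (shift^ c f) ≗ shift^ c (Δ^ a f)
Δ^-shift^ zero    c f m = refl
Δ^-shift^ (suc a) c f m = trans (Δ^-cong a (Δ-shift^ c f) m) (Δ^-shift^ a c (Δ f) m)

Δ-+ : ∀ f g m → Δ (λ k → f k +ℤ g k) m ≡ Δ f m +ℤ Δ g m
Δ-+ f g m = trans (cong (λ s → (f m +ℤ g m) -ℤ s) (shift-+ m))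
                  (solve 4 (λ x y u v → (x :+ y) :- (u :+ v) := (x :- u) :+ (y :- v)) refl (f m) (g m) (shift f m) (shift g m))
  where
  open +-*-Solver
  shift-+ : ∀ m → shift (λ k → f k +ℤ g k) m ≡ shift f m +ℤ shift g m
  shift-+ zero    = refl
  shift-+ (suc m) = refl

-- the power series 1/(1-t)^(a+1) and the constant 1
choose : ℕ → ℕ → ℤ
choose a m = + ((m + a) C a)

δ : ℕ → ℤ
δ m = + 𝟙 (m ≡ᵇ 0)

Δ-choose : ∀ a → Δ (choose (suc a)) ≗ choose a
Δ-choose a zero    = trans (ℤ.+-identityʳ _) (cong +_ (trans (nCn≡1 (suc a)) (sym (nCn≡1 a))))
Δ-choose a (suc m) = begin
  + (suc N C suc a) -ℤ + (N C suc a)              ≡⟨ cong (λ x → + x -ℤ + (N C suc a)) (nCk+nC[k+1]≡[n+1]C[k+1] N a) ⟨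
  + (N C a + N C suc a) -ℤ + (N C suc a)          ≡⟨ cong (_-ℤ + (N C suc a)) (ℤ.pos-+ (N C a) (N C suc a)) ⟩
  (+ (N C a) +ℤ + (N C suc a)) -ℤ + (N C suc a)   ≡⟨ solve 2 (λ x y → (x :+ y) :- y := x) refl (+ (N C a)) (+ (N C suc a)) ⟩
  + (N C a)                                       ≡⟨ cong (λ x → + (x C a)) (+-suc m a) ⟩
  + ((suc m + a) C a)                             ∎
  where
  open ≡-Reasoning
  open +-*-Solver
  N : ℕ
  N = m + suc a

Δ-choose-zero : Δ (choose 0) ≗ δ
Δ-choose-zero zero    = refl
Δ-choose-zero (suc m) = refl

Δ^-choose : ∀ a → Δ^ (suc a) (choose a) ≗ δ
Δ^-choose zero    = Δ-choose-zero
Δ^-choose (suc a) m = trans (Δ^-cong (suc a) (Δ-choose a) m) (Δ^-choose a m)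

shift^-δ : ∀ c m → shift^ c δ m ≡ + 𝟙 (does (c ≟ℕ m))
shift^-δ zero    zero    = refl
shift^-δ zero    (suc m) = refl
shift^-δ (suc c) zero    = refl
shift^-δ (suc c) (suc m) = shift^-δ c m

module ℤΣ = Algebra.Properties.CommutativeMonoid.Sum ℤ.+-0-commutativeMonoid

binomialTerm : ℕ → (ℕ → ℤ) → ℕ → ℕ → ℤ
binomialTerm a f m j = signℤ j *ℤ + (a C j) *ℤ shift^ j f m

-- the coefficient of t^m in (1 - t)^a f(t)
binomialSum : ℕ → (ℕ → ℤ) → ℕ → ℤ
binomialSum a f m = ℤΣ.sum (λ (j : Fin (suc a)) → binomialTerm a f m (toℕ j))

binomialSum-+ : ∀ a f g m → binomialSum a (λ k → f k +ℤ g k) m ≡ binomialSum a f m +ℤ binomialSum a g m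
binomialSum-+ a f g m = trans (ℤΣ.sum-cong-≗ {suc a} distrib) (ℤΣ.∑-distrib-+ {suc a} (λ j → binomialTerm a f m (toℕ j)) (λ j → binomialTerm a g m (toℕ j)))
  where
  distrib : ∀ (j : Fin (suc a)) → binomialTerm a (λ k → f k +ℤ g k) m (toℕ j) ≡ binomialTerm a f m (toℕ j) +ℤ binomialTerm a g m (toℕ j)
  distrib j = trans (cong (signℤ (toℕ j) *ℤ + (a C toℕ j) *ℤ_) (shift^-+ (toℕ j) f g m))
                    (ℤ.*-distribˡ-+ (signℤ (toℕ j) *ℤ + (a C toℕ j)) _ _)

binomialSum-Δ : ∀ a f m → binomialSum (suc a) f m ≡ binomialSum a (Δ f) m
binomialSum-Δ a f m = begin
  binomialSum (suc a) f m
    ≡⟨ cong (U zero +ℤ_) (ℤΣ.sum-cong-≗ {suc a} pascal) ⟩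
  U zero +ℤ ℤΣ.sum (λ i → U (suc i) +ℤ V i)
    ≡⟨ cong (U zero +ℤ_) (ℤΣ.∑-distrib-+ (U ∘ suc) V) ⟩
  U zero +ℤ (ℤΣ.sum (U ∘ suc) +ℤ ℤΣ.sum V)
    ≡⟨ ℤ.+-assoc (U zero) _ _ ⟨
  ℤΣ.sum U +ℤ ℤΣ.sum V
    ≡⟨ cong (_+ℤ ℤΣ.sum V) last-vanishes ⟩
  binomialSum a f m +ℤ binomialSum a (λ k → -ℤ shift f k) m
    ≡⟨ binomialSum-+ a f (λ k → -ℤ shift f k) m ⟨
  binomialSum a (Δ f) m ∎
  where
  open ≡-Reasoning
  U : Fin (suc (suc a)) → ℤ
  U j = binomialTerm a f m (toℕ j)
  V : Fin (suc a) → ℤ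
  V i = binomialTerm a (λ k → -ℤ shift f k) m (toℕ i)
  pascal : ∀ i → binomialTerm (suc a) f m (suc (toℕ i)) ≡ U (suc i) +ℤ V i
  pascal i = begin
    -ℤ s *ℤ + (suc a C suc j) *ℤ shift (shift^ j f) m
      ≡⟨ cong (λ c → -ℤ s *ℤ + c *ℤ shift (shift^ j f) m) (nCk+nC[k+1]≡[n+1]C[k+1] a j) ⟨
    -ℤ s *ℤ + (a C j + a C suc j) *ℤ shift (shift^ j f) m
      ≡⟨ cong (λ c → -ℤ s *ℤ c *ℤ shift (shift^ j f) m) (ℤ.pos-+ (a C j) (a C suc j)) ⟩
    -ℤ s *ℤ (+ (a C j) +ℤ + (a C suc j)) *ℤ shift (shift^ j f) m
      ≡⟨ solve 4 (λ s x y w → (:- s) :* (x :+ y) :* w := (:- s) :* y :* w :+ s :* x :* (:- w)) refl s (+ (a C j)) (+ (a C suc j)) (shift (shift^ j f) m) ⟩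
    U (suc i) +ℤ s *ℤ + (a C j) *ℤ (-ℤ shift (shift^ j f) m)
      ≡⟨ cong (λ w → U (suc i) +ℤ s *ℤ + (a C j) *ℤ w) (trans (shift^-neg j (shift f) m) (cong -ℤ_ (shift^-comm j f m))) ⟨
    U (suc i) +ℤ V i ∎
    where
    open +-*-Solver
    j : ℕ
    j = toℕ i
    s : ℤ
    s = signℤ j
  last-vanishes : ℤΣ.sum U ≡ binomialSum a f m
  last-vanishes = begin
    ℤΣ.sum U
      ≡⟨ ℤΣ.sum-init-last U ⟩
    ℤΣ.sum (U ∘ Fin.inject₁) +ℤ U (Fin.fromℕ (suc a))
      ≡⟨ cong₂ _+ℤ_ (ℤΣ.sum-cong-≗ {suc a} (cong (binomialTerm a f m) ∘ toℕ-inject₁)) (cong (binomialTerm a f m) (toℕ-fromℕ (suc a))) ⟩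
    binomialSum a f m +ℤ binomialTerm a f m (suc a)
      ≡⟨ cong (λ c → binomialSum a f m +ℤ signℤ (suc a) *ℤ + c *ℤ shift^ (suc a) f m) (k>n⇒nCk≡0 (n<1+n a)) ⟩
    binomialSum a f m +ℤ signℤ (suc a) *ℤ + 0 *ℤ shift^ (suc a) f m
      ≡⟨ cong (λ z → binomialSum a f m +ℤ z *ℤ shift^ (suc a) f m) (ℤ.*-zeroʳ (signℤ (suc a))) ⟩
    binomialSum a f m +ℤ + 0 *ℤ shift^ (suc a) f m
      ≡⟨ ℤ.+-identityʳ (binomialSum a f m) ⟩
    binomialSum a f m ∎

binomialSum≡Δ^ : ∀ a f m → binomialSum a f m ≡ Δ^ a f m
binomialSum≡Δ^ zero    f m = trans (ℤ.+-identityʳ _) (ℤ.*-identityˡ (f m))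
binomialSum≡Δ^ (suc a) f m = trans (binomialSum-Δ a f m) (binomialSum≡Δ^ a (Δ f) m)

sumℤ-applyUpTo : ∀ (g : ℕ → ℤ) (h : ℕ → ℕ) k → sumℤ (map g (applyUpTo h k)) ≡ ℤΣ.sum (λ (j : Fin k) → g (h (toℕ j)))
sumℤ-applyUpTo g h zero    = refl
sumℤ-applyUpTo g h (suc k) = cong (g (h 0) +ℤ_) (sumℤ-applyUpTo g (h ∘ suc) k)

WCoeff≡Δ^χ : ∀ {d} (G : SimpleGraph d) m → WCoeff G m ≡ Δ^ (suc d) (λ k → + χ G k) m
WCoeff≡Δ^χ {d} G m = begin
  WCoeff G m
    ≡⟨ sumℤ-applyUpTo (λ j → if j ≤ᵇ m then signℤ j *ℤ + (suc d C j) *ℤ + χ G (m ∸ j) else + 0) (λ j → j) (suc (suc d)) ⟩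
  ℤΣ.sum (λ (j : Fin (suc (suc d))) → if toℕ j ≤ᵇ m then signℤ (toℕ j) *ℤ + (suc d C toℕ j) *ℤ + χ G (m ∸ toℕ j) else + 0)
    ≡⟨ ℤΣ.sum-cong-≗ {suc (suc d)} (λ j → term≡ (toℕ j)) ⟩
  binomialSum (suc d) (λ k → + χ G k) m
    ≡⟨ binomialSum≡Δ^ (suc d) (λ k → + χ G k) m ⟩
  Δ^ (suc d) (λ k → + χ G k) m ∎
  where
  open ≡-Reasoning
  term≡ : ∀ j → (if j ≤ᵇ m then signℤ j *ℤ + (suc d C j) *ℤ + χ G (m ∸ j) else + 0) ≡ binomialTerm (suc d) (λ k → + χ G k) m j
  term≡ j = trans (by-cases (j ≤ᵇ m)) (cong (signℤ j *ℤ + (suc d C j) *ℤ_) (sym (shift^-apply j (λ k → + χ G k) m)))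
    where
    by-cases : ∀ b → (if b then signℤ j *ℤ + (suc d C j) *ℤ + χ G (m ∸ j) else + 0)
                     ≡ signℤ j *ℤ + (suc d C j) *ℤ (if b then + χ G (m ∸ j) else + 0)
    by-cases true  = refl
    by-cases false = sym (ℤ.*-zeroʳ (signℤ j *ℤ + (suc d C j)))

Δ-sumℤ : ∀ {A : Set} (g : A → ℕ → ℤ) xs m →
         Δ (λ k → sumℤ (map (λ x → g x k) xs)) m ≡ sumℤ (map (λ x → Δ (g x) m) xs)
Δ-sumℤ g []       zero    = refl
Δ-sumℤ g []       (suc m) = refl
Δ-sumℤ g (x ∷ xs) m = trans (Δ-+ (g x) (λ k → sumℤ (map (λ y → g y k) xs)) m) (cong (Δ (g x) m +ℤ_) (Δ-sumℤ g xs m))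

Δ^-sumℤ : ∀ {A : Set} a (g : A → ℕ → ℤ) xs m →
          Δ^ a (λ k → sumℤ (map (λ x → g x k) xs)) m ≡ sumℤ (map (λ x → Δ^ a (g x) m) xs)
Δ^-sumℤ zero    g xs m = refl
Δ^-sumℤ (suc a) g xs m = trans (Δ^-cong a (Δ-sumℤ g xs) m) (Δ^-sumℤ a (λ x → Δ (g x)) xs m)

pos-sumOver : ∀ {A : Set} (f : A → ℕ) xs → + sumOver f xs ≡ sumℤ (map (λ x → + f x) xs)
pos-sumOver f []       = refl
pos-sumOver f (x ∷ xs) = trans (ℤ.pos-+ (f x) (sumOver f xs)) (cong (+ f x +ℤ_) (pos-sumOver f xs))

risingSeries : ∀ {d} → SimpleGraph d → (Fin d → Fin d) → ℕ → ℤ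
risingSeries {d} G p n = + ∑[ x ∈ allMaps d n ] 𝟙 (isRising 0 (cutAt G p) x)

risingSeries≗ : ∀ {d} (G : SimpleGraph d) p → risingSeries G p ≗ shift^ (cuts G p) (choose d)
risingSeries≗ {d} G p n = begin
  risingSeries G p n
    ≡⟨ cong +_ (risingCount-closed G p n) ⟩
  + (if cuts G p ≤ᵇ n then (n ∸ cuts G p + d) C d else 0)
    ≡⟨ if-float +_ (cuts G p ≤ᵇ n) ⟩
  (if cuts G p ≤ᵇ n then choose d (n ∸ cuts G p) else + 0)
    ≡⟨ shift^-apply (cuts G p) (choose d) n ⟨
  shift^ (cuts G p) (choose d) n ∎
  where open ≡-Reasoning

WCoeff≡cutCoeff : ∀ {d} (G : SimpleGraph d) m → WCoeff G m ≡ + cutCoeff G m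
WCoeff≡cutCoeff {d} G m = begin
  WCoeff G m
    ≡⟨ WCoeff≡Δ^χ G m ⟩
  Δ^ (suc d) (λ k → + χ G k) m
    ≡⟨ Δ^-cong (suc d) (λ k → trans (cong +_ (χ≡∑rising G k)) (pos-sumOver _ (perms d))) m ⟩
  Δ^ (suc d) (λ k → sumℤ (map (λ p → risingSeries G p k) (perms d))) m
    ≡⟨ Δ^-sumℤ (suc d) (risingSeries G) (perms d) m ⟩
  sumℤ (map (λ p → Δ^ (suc d) (risingSeries G p) m) (perms d))
    ≡⟨ cong sumℤ (map-cong cut-indicator (perms d)) ⟩
  sumℤ (map (λ p → + 𝟙 (does (cuts G p ≟ℕ m))) (perms d))
    ≡⟨ pos-sumOver (λ p → 𝟙 (does (cuts G p ≟ℕ m))) (perms d) ⟨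
  + ∑[ p ∈ perms d ] 𝟙 (does (cuts G p ≟ℕ m))
    ≡⟨ cong +_ (length-filter≡sumOver (λ p → cuts G p ≟ℕ m) (perms d)) ⟨
  + cutCoeff G m ∎
  where
  open ≡-Reasoning
  cut-indicator : ∀ p → Δ^ (suc d) (risingSeries G p) m ≡ + 𝟙 (does (cuts G p ≟ℕ m))
  cut-indicator p = begin
    Δ^ (suc d) (risingSeries G p) m                ≡⟨ Δ^-cong (suc d) (risingSeries≗ G p) m ⟩
    Δ^ (suc d) (shift^ (cuts G p) (choose d)) m    ≡⟨ Δ^-shift^ (suc d) (cuts G p) (choose d) m ⟩
    shift^ (cuts G p) (Δ^ (suc d) (choose d)) m    ≡⟨ shift^-cong (cuts G p) (Δ^-choose d) m ⟩
    shift^ (cuts G p) δ m                          ≡⟨ shift^-δ (cuts G p) m ⟩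
    + 𝟙 (does (cuts G p ≟ℕ m))                     ∎

WCoeff-relabel : ∀ {d} (G : SimpleGraph d) σ m → WCoeff (relabel G σ) m ≡ WCoeff G m
WCoeff-relabel {d} G σ m = begin
  WCoeff (relabel G σ) m                  ≡⟨ WCoeff≡Δ^χ (relabel G σ) m ⟩
  Δ^ (suc d) (λ k → + χ (relabel G σ) k) m ≡⟨ Δ^-cong (suc d) (cong +_ ∘ χ-relabel G σ) m ⟩
  Δ^ (suc d) (λ k → + χ G k) m            ≡⟨ WCoeff≡Δ^χ G m ⟨
  WCoeff G m                              ∎
  where open ≡-Reasoning

cutCoeff-relabel : ∀ {d} (G : SimpleGraph d) σ m → cutCoeff (relabel G σ) m ≡ cutCoeff G m
cutCoeff-relabel G σ m = ℤ.+-injective (begin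
  + cutCoeff (relabel G σ) m   ≡⟨ WCoeff≡cutCoeff (relabel G σ) m ⟨
  WCoeff (relabel G σ) m       ≡⟨ WCoeff-relabel G σ m ⟩
  WCoeff G m                   ≡⟨ WCoeff≡cutCoeff G m ⟩
  + cutCoeff G m               ∎)
  where open ≡-Reasoning

theorem1p6 : (d : ℕ) (G : SimpleGraph d) →
    ((m : ℕ) → WCoeff G m ≡ + cutCoeff G m)
    × ((σ : Permutation′ d) (m : ℕ) → cutCoeff (relabel G σ) m ≡ cutCoeff G m)
theorem1p6 d G = WCoeff≡cutCoeff G , cutCoeff-relabel G
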